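{- Let $n$ be a positive integer, and define polynomials $Q_k(x)$, $k=0,1,2,\dots$, by $Q_0(x)=1-x^n$ and \[Q_{k+1}(x)=Q_k(x)+\frac{1-x}{k+1}\,Q_k'(x)\qquad (k=0,1,2,\dots).\] Then for every $k\ge 0$ the following three expressions are all equal to $Q_k(x)$: \begin{enumerate} \item $\displaystyle Q_k(x)=1-\sum_{j=0}^k\binom{n}{j}(1-x)^jx^{n-j}$; \item $\displaystyle Q_k(x)=-(n-k)\binom{n}{k}(-1)^{n+k}\sum_{r\ge 1}\binom{k}{n-r}\frac{(-1)^r}{r}x^r+\begin{cases}1,&\text{if } k<n,\\ 0,&\text{otherwise;}\end{cases}$ \item $\displaystyle Q_k(x)=(1-x)^{k+1}\sum_{j=0}^{n-k-1}\binom{j+k}{j}x^j$ (an empty sum being $0$). \end{enumerate} Moreover, the generating function is $\sum_{k\ge 0}Q_k(x)t^k=\dfrac{1-\bigl(1-(1-t)(1-x)\bigr)^n}{1-t}$.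
   Context: Binomial coefficients $\binom{a}{b}$ with $b<0$ or $b>a\ge 0$ (for integer $a\ge 0$) are taken to be $0$. -}

module Defs where

open import Data.Nat as ℕ using (ℕ; zero; suc)
open import Data.Nat.Combinatorics using (_C_)
open import Data.Integer using (+_)
open import Data.Rational as ℚ using (ℚ; 0ℚ; 1ℚ; _/_)
open import Data.List using (List; []; _∷_; map; foldr; upTo)
open import Relation.Binary.PropositionalEquality using (_≡_)

ℕ→ℚ : ℕ → ℚ
ℕ→ℚ m = + m / 1

_^ℚ_ : ℚ → ℕ → ℚ
a ^ℚ zero = 1ℚ
a ^ℚ suc r = a ℚ.* (a ^ℚ r)

-- Univariate polynomials over ℚ, as coefficient lists (constant term
-- first).  Two lists denote the same polynomial iff all coefficients
-- agree (trailing zeros are irrelevant): see _≈P_.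

Poly : Set
Poly = List ℚ

coeff : Poly → ℕ → ℚ
coeff []       _       = 0ℚ
coeff (a ∷ p)  zero    = a
coeff (a ∷ p)  (suc i) = coeff p i

infix 4 _≈P_
_≈P_ : Poly → Poly → Set
p ≈P q = ∀ i → coeff p i ≡ coeff q i

infixl 6 _+P_ _-P_
infixl 7 _*P_ _·P_

_+P_ : Poly → Poly → Poly
[]      +P q       = q
(a ∷ p) +P []      = a ∷ p
(a ∷ p) +P (b ∷ q) = (a ℚ.+ b) ∷ (p +P q)

_·P_ : ℚ → Poly → Poly
c ·P p = map (c ℚ.*_) p

-P_ : Poly → Poly
-P p = map ℚ.-_ p

_-P_ : Poly → Poly → Poly
p -P q = p +P (-P q)

_*P_ : Poly → Poly → Poly
[]      *P q = []
(a ∷ p) *P q = (a ·P q) +P (0ℚ ∷ (p *P q))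

constP : ℚ → Poly
constP c = c ∷ []

oneP : Poly
oneP = constP 1ℚ

X : Poly
X = 0ℚ ∷ 1ℚ ∷ []

_^P_ : Poly → ℕ → Poly
p ^P zero  = oneP
p ^P suc m = p *P (p ^P m)

derivAux : ℕ → Poly → Poly
derivAux k []      = []
derivAux k (a ∷ p) = (ℕ→ℚ k ℚ.* a) ∷ derivAux (suc k) p

deriv : Poly → Poly
deriv []      = []
deriv (a ∷ p) = derivAux 1 p

sumP : ℕ → (ℕ → Poly) → Poly
sumP m f = foldr _+P_ [] (map f (upTo m))

Q : ℕ → ℕ → Poly
Q n zero    = oneP -P (X ^P n)
Q n (suc k) = Q n k +P ((+ 1 / suc k) ·P ((oneP -P X) *P deriv (Q n k)))

-- Formal power series in t with polynomial (in x) coefficients: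
-- a series is its coefficient sequence k ↦ [t^k].

Ser : Set
Ser = ℕ → Poly

infix 4 _≈S_
_≈S_ : Ser → Ser → Set
F ≈S G = ∀ k → F k ≈P G k

infixl 6 _+S_ _-S_
infixl 7 _*S_

_+S_ : Ser → Ser → Ser
(F +S G) k = F k +P G k

_-S_ : Ser → Ser → Ser
(F -S G) k = F k -P G k

_*S_ : Ser → Ser → Ser
(F *S G) k = sumP (suc k) (λ i → F i *P G (k ℕ.∸ i))

constS : Poly → Ser
constS p zero    = p
constS p (suc k) = []

oneS : Ser
oneS = constS oneP

T : Ser
T (suc zero) = oneP
T _          = []

_^S_ : Ser → ℕ → Ser
F ^S zero  = oneS
F ^S suc m = F *S (F ^S m)

open import Data.Bool using (if_then_else_)
indLt : ℕ → ℕ → ℚ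
indLt k n = if k ℕ.<ᵇ n then 1ℚ else 0ℚ

{-# OPTIONS --safe #-}
-- Write y = 1 - x and F_k = ∑_{j ≤ k} C(n,j) yʲ x^(n-j). Differentiating F_k telescopes to
-- F_k' = (n-k) C(n,k) yᵏ x^(n-k-1), and y F_k' / (k+1) is the next term C(n,k+1) y^(k+1) x^(n-k-1),
-- so 1 - F_k satisfies the recursion: this is (1). The recursion sends y^(k+1) s to
-- y^(k+2) s' / (k+1), and s ↦ s' / (k+1) turns the truncation of (1-x)^-(k+1) into the one-term
-- shorter truncation of (1-x)^-(k+2); with the geometric sum as base case this is (3).
-- The right-hand side of (2) has the constant term [k < n] that (3) gives for Q_k, and by the
-- binomial theorem its derivative is -(n-k) C(n,k) yᵏ x^(n-k-1), which is Q_k' by (1).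
-- Finally, (1 - t) ∑ Q_k tᵏ has the coefficients 1 - xⁿ and Q_k - Q_(k-1) = -C(n,k) yᵏ x^(n-k),
-- which are those of 1 - (x + y t)ⁿ, and x + y t = 1 - (1 - t)(1 - x).
module Submission where

open import Algebra.Bundles using (CommutativeRing)
import Algebra.Solver.Ring as RingSolver
import Algebra.Solver.Ring.AlmostCommutativeRing as ACR
open import Data.Integer using (+_)
import Data.Integer as ℤ using (_+_; _*_)
import Data.Integer.Properties as ℤ using (*-identityʳ)
open import Data.List using ([]; _∷_; foldr)
open import Data.List.Properties using (map-applyUpTo)
open import Data.Maybe as Maybe using (Maybe)
open import Data.Nat as ℕ using (ℕ; zero; suc; pred; _+_; _∸_; _≤_; s≤s)
import Data.Nat.Properties as ℕ
open import Data.Nat.Combinatorics using (_C_; nCk+nC[k+1]≡[n+1]C[k+1]; nC1≡n; nCn≡1; k>n⇒nCk≡0)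
import Data.Nat.Coprimality as Coprimality
open import Data.Product using (_×_; _,_; proj₁; proj₂)
open import Data.Rational as ℚ using (ℚ; 0ℚ; 1ℚ; mkℚ; _*_; _-_; -_; _/_)
import Data.Rational.Properties as ℚ
open import Data.Rational.Solver using () renaming (module +-*-Solver to ℚSolver)
open import Data.Nat.Solver using () renaming (module +-*-Solver to NatSolver)
open import Data.Sum using (_⊎_; inj₁; inj₂)
open import Function using (_∘_; id)
open import Relation.Binary.Bundles using (Setoid)
open import Relation.Binary.Consequences using (dec⇒weaklyDec)
open import Relation.Binary.PropositionalEquality
open import Relation.Binary.Structures using (IsEquivalence)
import Relation.Binary.Reasoning.Setoid as SetoidReasoning

open import Defs

-- _≈P_ unfolds to a Π-type from whose inhabitants Agda cannot infer the two
-- polynomials; the record makes them inferable.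
infix 4 _≋_
record _≋_ (p q : Poly) : Set where
  constructor mk≋
  field ≋-coeff : p ≈P q
open _≋_ public

≋-refl : ∀ {p} → p ≋ p
≋-refl = mk≋ λ _ → refl

≋-sym : ∀ {p q} → p ≋ q → q ≋ p
≋-sym e = mk≋ λ i → sym (≋-coeff e i)

≋-trans : ∀ {p q r} → p ≋ q → q ≋ r → p ≋ r
≋-trans e f = mk≋ λ i → trans (≋-coeff e i) (≋-coeff f i)

≋-isEquivalence : IsEquivalence _≋_
≋-isEquivalence = record { refl = ≋-refl ; sym = ≋-sym ; trans = ≋-trans }

≋-setoid : Setoid _ _
≋-setoid = record { isEquivalence = ≋-isEquivalence }

module ≋-Reasoning = SetoidReasoning ≋-setoid

≡⇒≋ : ∀ {p q} → p ≡ q → p ≋ q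
≡⇒≋ refl = ≋-refl

∷-cong : ∀ {a b p q} → a ≡ b → p ≋ q → a ∷ p ≋ b ∷ q
∷-cong a≡b p≋q = mk≋ λ { zero → a≡b ; (suc i) → ≋-coeff p≋q i }

∷-injective : ∀ {a b p q} → a ∷ p ≋ b ∷ q → a ≡ b × p ≋ q
∷-injective e = ≋-coeff e zero , mk≋ λ i → ≋-coeff e (suc i)

∷≋[] : ∀ {a p} → a ≡ 0ℚ → p ≋ [] → a ∷ p ≋ []
∷≋[] a≡0 p≋[] = mk≋ λ { zero → a≡0 ; (suc i) → ≋-coeff p≋[] i }

∷≋[]-inv : ∀ {a p} → a ∷ p ≋ [] → a ≡ 0ℚ × p ≋ []
∷≋[]-inv e = ≋-coeff e zero , mk≋ λ i → ≋-coeff e (suc i)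

coeff-+P : ∀ p q i → coeff (p +P q) i ≡ coeff p i ℚ.+ coeff q i
coeff-+P []      q       i       = sym (ℚ.+-identityˡ (coeff q i))
coeff-+P (a ∷ p) []      i       = sym (ℚ.+-identityʳ (coeff (a ∷ p) i))
coeff-+P (a ∷ p) (b ∷ q) zero    = refl
coeff-+P (a ∷ p) (b ∷ q) (suc i) = coeff-+P p q i

coeff-·P : ∀ c p i → coeff (c ·P p) i ≡ c ℚ.* coeff p i
coeff-·P c []      i       = sym (ℚ.*-zeroʳ c)
coeff-·P c (a ∷ p) zero    = refl
coeff-·P c (a ∷ p) (suc i) = coeff-·P c p i

coeff--P : ∀ p i → coeff (-P p) i ≡ ℚ.- coeff p i
coeff--P []      i       = refl
coeff--P (a ∷ p) zero    = refl
coeff--P (a ∷ p) (suc i) = coeff--P p i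

+P-cong : ∀ {p p′ q q′} → p ≋ p′ → q ≋ q′ → p +P q ≋ p′ +P q′
+P-cong {p} {p′} {q} {q′} e f = mk≋ λ i →
  trans (coeff-+P p q i) (trans (cong₂ ℚ._+_ (≋-coeff e i) (≋-coeff f i)) (sym (coeff-+P p′ q′ i)))

+P-congˡ : ∀ {p p′} q → p ≋ p′ → p +P q ≋ p′ +P q
+P-congˡ q e = +P-cong e (≋-refl {q})

+P-congʳ : ∀ p {q q′} → q ≋ q′ → p +P q ≋ p +P q′
+P-congʳ p e = +P-cong (≋-refl {p}) e

-P-cong : ∀ {p p′} → p ≋ p′ → -P p ≋ -P p′
-P-cong {p} {p′} e = mk≋ λ i →
  trans (coeff--P p i) (trans (cong ℚ.-_ (≋-coeff e i)) (sym (coeff--P p′ i)))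

·P-cong : ∀ {c c′ p p′} → c ≡ c′ → p ≋ p′ → c ·P p ≋ c′ ·P p′
·P-cong {c} {_} {p} {p′} refl e = mk≋ λ i →
  trans (coeff-·P c p i) (trans (cong (c ℚ.*_) (≋-coeff e i)) (sym (coeff-·P c p′ i)))

·P-congˡ : ∀ {c c′} p → c ≡ c′ → c ·P p ≋ c′ ·P p
·P-congˡ p e = ·P-cong e (≋-refl {p})

·P-congʳ : ∀ c {p p′} → p ≋ p′ → c ·P p ≋ c ·P p′
·P-congʳ c e = ·P-cong {c} refl e

+P-comm : ∀ p q → p +P q ≋ q +P p
+P-comm p q = mk≋ λ i →
  trans (coeff-+P p q i) (trans (ℚ.+-comm (coeff p i) (coeff q i)) (sym (coeff-+P q p i)))

+P-assoc : ∀ p q r → (p +P q) +P r ≋ p +P (q +P r)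
+P-assoc p q r = mk≋ λ i → begin
  coeff ((p +P q) +P r) i                  ≡⟨ coeff-+P (p +P q) r i ⟩
  coeff (p +P q) i ℚ.+ coeff r i           ≡⟨ cong (ℚ._+ coeff r i) (coeff-+P p q i) ⟩
  (coeff p i ℚ.+ coeff q i) ℚ.+ coeff r i  ≡⟨ ℚ.+-assoc (coeff p i) (coeff q i) (coeff r i) ⟩
  coeff p i ℚ.+ (coeff q i ℚ.+ coeff r i)  ≡⟨ cong (coeff p i ℚ.+_) (coeff-+P q r i) ⟨
  coeff p i ℚ.+ coeff (q +P r) i           ≡⟨ coeff-+P p (q +P r) i ⟨
  coeff (p +P (q +P r)) i                  ∎
  where open ≡-Reasoning

+P-identityʳ : ∀ p → p +P [] ≋ p
+P-identityʳ p = mk≋ λ i → trans (coeff-+P p [] i) (ℚ.+-identityʳ (coeff p i))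

+P-inverseʳ : ∀ p → p -P p ≋ []
+P-inverseʳ p = mk≋ λ i →
  trans (coeff-+P p (-P p) i) (trans (cong (coeff p i ℚ.+_) (coeff--P p i)) (ℚ.+-inverseʳ (coeff p i)))

+P-inverseˡ : ∀ p → (-P p) +P p ≋ []
+P-inverseˡ p = ≋-trans (+P-comm (-P p) p) (+P-inverseʳ p)

+P-swap : ∀ p q r → p +P (q +P r) ≋ q +P (p +P r)
+P-swap p q r =
  ≋-trans (≋-sym (+P-assoc p q r)) (≋-trans (+P-congˡ r (+P-comm p q)) (+P-assoc q p r))

·P-distribˡ : ∀ c p q → c ·P (p +P q) ≋ c ·P p +P c ·P q
·P-distribˡ c p q = mk≋ λ i → begin
  coeff (c ·P (p +P q)) i                   ≡⟨ coeff-·P c (p +P q) i ⟩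
  c ℚ.* coeff (p +P q) i                    ≡⟨ cong (c ℚ.*_) (coeff-+P p q i) ⟩
  c ℚ.* (coeff p i ℚ.+ coeff q i)           ≡⟨ ℚ.*-distribˡ-+ c (coeff p i) (coeff q i) ⟩
  c ℚ.* coeff p i ℚ.+ c ℚ.* coeff q i       ≡⟨ cong₂ ℚ._+_ (coeff-·P c p i) (coeff-·P c q i) ⟨
  coeff (c ·P p) i ℚ.+ coeff (c ·P q) i     ≡⟨ coeff-+P (c ·P p) (c ·P q) i ⟨
  coeff (c ·P p +P c ·P q) i                ∎
  where open ≡-Reasoning

·P-distribʳ : ∀ a b p → (a ℚ.+ b) ·P p ≋ a ·P p +P b ·P p
·P-distribʳ a b p = mk≋ λ i → begin
  coeff ((a ℚ.+ b) ·P p) i                  ≡⟨ coeff-·P (a ℚ.+ b) p i ⟩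
  (a ℚ.+ b) ℚ.* coeff p i                   ≡⟨ ℚ.*-distribʳ-+ (coeff p i) a b ⟩
  a ℚ.* coeff p i ℚ.+ b ℚ.* coeff p i       ≡⟨ cong₂ ℚ._+_ (coeff-·P a p i) (coeff-·P b p i) ⟨
  coeff (a ·P p) i ℚ.+ coeff (b ·P p) i     ≡⟨ coeff-+P (a ·P p) (b ·P p) i ⟨
  coeff (a ·P p +P b ·P p) i                ∎
  where open ≡-Reasoning

·P-assoc : ∀ a b p → a ·P (b ·P p) ≋ (a ℚ.* b) ·P p
·P-assoc a b p = mk≋ λ i → begin
  coeff (a ·P (b ·P p)) i    ≡⟨ coeff-·P a (b ·P p) i ⟩
  a ℚ.* coeff (b ·P p) i     ≡⟨ cong (a ℚ.*_) (coeff-·P b p i) ⟩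
  a ℚ.* (b ℚ.* coeff p i)    ≡⟨ ℚ.*-assoc a b (coeff p i) ⟨
  (a ℚ.* b) ℚ.* coeff p i    ≡⟨ coeff-·P (a ℚ.* b) p i ⟨
  coeff ((a ℚ.* b) ·P p) i   ∎
  where open ≡-Reasoning

·P-identityˡ : ∀ p → 1ℚ ·P p ≋ p
·P-identityˡ p = mk≋ λ i → trans (coeff-·P 1ℚ p i) (ℚ.*-identityˡ (coeff p i))

·P-zeroˡ : ∀ p → 0ℚ ·P p ≋ []
·P-zeroˡ p = mk≋ λ i → trans (coeff-·P 0ℚ p i) (ℚ.*-zeroˡ (coeff p i))

-·P : ∀ a p → (ℚ.- a) ·P p ≋ -P (a ·P p)
-·P a p = mk≋ λ i → begin
  coeff ((ℚ.- a) ·P p) i     ≡⟨ coeff-·P (ℚ.- a) p i ⟩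
  ℚ.- a ℚ.* coeff p i        ≡⟨ ℚ.neg-distribˡ-* a (coeff p i) ⟨
  ℚ.- (a ℚ.* coeff p i)      ≡⟨ cong ℚ.-_ (coeff-·P a p i) ⟨
  ℚ.- coeff (a ·P p) i       ≡⟨ coeff--P (a ·P p) i ⟨
  coeff (-P (a ·P p)) i      ∎
  where open ≡-Reasoning

·P--P : ∀ a p → a ·P (-P p) ≋ -P (a ·P p)
·P--P a p = mk≋ λ i → begin
  coeff (a ·P (-P p)) i      ≡⟨ coeff-·P a (-P p) i ⟩
  a ℚ.* coeff (-P p) i       ≡⟨ cong (a ℚ.*_) (coeff--P p i) ⟩
  a ℚ.* ℚ.- coeff p i        ≡⟨ ℚ.neg-distribʳ-* a (coeff p i) ⟨
  ℚ.- (a ℚ.* coeff p i)      ≡⟨ cong ℚ.-_ (coeff-·P a p i) ⟨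
  ℚ.- coeff (a ·P p) i       ≡⟨ coeff--P (a ·P p) i ⟨
  coeff (-P (a ·P p)) i      ∎
  where open ≡-Reasoning

*P-zeroʳ : ∀ p → p *P [] ≋ []
*P-zeroʳ []      = ≋-refl
*P-zeroʳ (a ∷ p) = ∷≋[] refl (*P-zeroʳ p)

*P-zero-≋ˡ : ∀ {p} q → p ≋ [] → p *P q ≋ []
*P-zero-≋ˡ {[]}    q e = ≋-refl
*P-zero-≋ˡ {a ∷ p} q e = +P-cong (≋-trans (·P-congˡ q a≡0) (·P-zeroˡ q)) (∷≋[] refl (*P-zero-≋ˡ q p≋[]))
  where a≡0 = proj₁ (∷≋[]-inv e)
        p≋[] = proj₂ (∷≋[]-inv e)

*P-congˡ : ∀ {p p′} q → p ≋ p′ → p *P q ≋ p′ *P q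
*P-congˡ {[]}    {p′}     q e = ≋-sym (*P-zero-≋ˡ q (≋-sym e))
*P-congˡ {a ∷ p} {[]}     q e = *P-zero-≋ˡ q e
*P-congˡ {a ∷ p} {b ∷ p′} q e =
  +P-cong (·P-congˡ q (proj₁ (∷-injective e))) (∷-cong refl (*P-congˡ q (proj₂ (∷-injective e))))

*P-congʳ : ∀ p {q q′} → q ≋ q′ → p *P q ≋ p *P q′
*P-congʳ []      e = ≋-refl
*P-congʳ (a ∷ p) e = +P-cong (·P-congʳ a e) (∷-cong refl (*P-congʳ p e))

*P-cong : ∀ {p p′ q q′} → p ≋ p′ → q ≋ q′ → p *P q ≋ p′ *P q′
*P-cong {p′ = p′} {q = q} e f = ≋-trans (*P-congˡ q e) (*P-congʳ p′ f)

·P-0∷ : ∀ c p → c ·P (0ℚ ∷ p) ≋ 0ℚ ∷ c ·P p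
·P-0∷ c p = ∷-cong (ℚ.*-zeroʳ c) ≋-refl

0∷-*P : ∀ p q → (0ℚ ∷ p) *P q ≋ 0ℚ ∷ p *P q
0∷-*P p q = +P-congˡ (0ℚ ∷ p *P q) (·P-zeroˡ q)

*P-distribʳ : ∀ p q r → (p +P q) *P r ≋ p *P r +P q *P r
*P-distribʳ []      q       r = ≋-refl
*P-distribʳ (a ∷ p) []      r = ≋-sym (+P-identityʳ ((a ∷ p) *P r))
*P-distribʳ (a ∷ p) (b ∷ q) r = begin
  (a ℚ.+ b) ·P r +P (0ℚ ∷ (p +P q) *P r)
    ≈⟨ +P-cong (·P-distribʳ a b r) (∷-cong refl (*P-distribʳ p q r)) ⟩
  (a ·P r +P b ·P r) +P ((0ℚ ∷ p *P r) +P (0ℚ ∷ q *P r))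
    ≈⟨ +P-assoc (a ·P r) (b ·P r) _ ⟩
  a ·P r +P (b ·P r +P ((0ℚ ∷ p *P r) +P (0ℚ ∷ q *P r)))
    ≈⟨ +P-congʳ (a ·P r) (+P-swap (b ·P r) (0ℚ ∷ p *P r) (0ℚ ∷ q *P r)) ⟩
  a ·P r +P ((0ℚ ∷ p *P r) +P (b ·P r +P (0ℚ ∷ q *P r)))
    ≈⟨ +P-assoc (a ·P r) (0ℚ ∷ p *P r) (b ·P r +P (0ℚ ∷ q *P r)) ⟨
  (a ·P r +P (0ℚ ∷ p *P r)) +P (b ·P r +P (0ℚ ∷ q *P r))
    ∎
  where open ≋-Reasoning

·P-*P : ∀ c p q → (c ·P p) *P q ≋ c ·P (p *P q)
·P-*P c []      q = ≋-refl
·P-*P c (a ∷ p) q = begin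
  (c ℚ.* a) ·P q +P (0ℚ ∷ (c ·P p) *P q)  ≈⟨ +P-cong (≋-sym (·P-assoc c a q)) (∷-cong refl (·P-*P c p q)) ⟩
  c ·P (a ·P q) +P (0ℚ ∷ c ·P (p *P q))   ≈⟨ +P-congʳ (c ·P (a ·P q)) (·P-0∷ c (p *P q)) ⟨
  c ·P (a ·P q) +P c ·P (0ℚ ∷ p *P q)     ≈⟨ ·P-distribˡ c (a ·P q) (0ℚ ∷ p *P q) ⟨
  c ·P (a ·P q +P (0ℚ ∷ p *P q))          ∎
  where open ≋-Reasoning

*P-∷ : ∀ p b q → p *P (b ∷ q) ≋ b ·P p +P (0ℚ ∷ p *P q)
*P-∷ []      b q = ≋-sym (∷≋[] refl ≋-refl)
*P-∷ (a ∷ p) b q = ∷-cong (cong (ℚ._+ 0ℚ) (ℚ.*-comm a b)) (begin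
  a ·P q +P p *P (b ∷ q)                  ≈⟨ +P-congʳ (a ·P q) (*P-∷ p b q) ⟩
  a ·P q +P (b ·P p +P (0ℚ ∷ p *P q))     ≈⟨ +P-swap (a ·P q) (b ·P p) (0ℚ ∷ p *P q) ⟩
  b ·P p +P (a ·P q +P (0ℚ ∷ p *P q))     ∎)
  where open ≋-Reasoning

*P-comm : ∀ p q → p *P q ≋ q *P p
*P-comm []      q = ≋-sym (*P-zeroʳ q)
*P-comm (a ∷ p) q = ≋-trans (+P-congʳ (a ·P q) (∷-cong refl (*P-comm p q))) (≋-sym (*P-∷ q a p))

*P-·P : ∀ c p q → p *P (c ·P q) ≋ c ·P (p *P q)
*P-·P c p q = ≋-trans (*P-comm p (c ·P q)) (≋-trans (·P-*P c q p) (·P-congʳ c (*P-comm q p)))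

*P-assoc : ∀ p q r → (p *P q) *P r ≋ p *P (q *P r)
*P-assoc []      q r = ≋-refl
*P-assoc (a ∷ p) q r = begin
  (a ·P q +P (0ℚ ∷ p *P q)) *P r            ≈⟨ *P-distribʳ (a ·P q) (0ℚ ∷ p *P q) r ⟩
  (a ·P q) *P r +P (0ℚ ∷ p *P q) *P r       ≈⟨ +P-cong (·P-*P a q r) (0∷-*P (p *P q) r) ⟩
  a ·P (q *P r) +P (0ℚ ∷ (p *P q) *P r)     ≈⟨ +P-congʳ (a ·P (q *P r)) (∷-cong refl (*P-assoc p q r)) ⟩
  a ·P (q *P r) +P (0ℚ ∷ p *P (q *P r))     ∎
  where open ≋-Reasoning

*P-identityˡ : ∀ p → oneP *P p ≋ p
*P-identityˡ p = ≋-trans (+P-congʳ (1ℚ ·P p) (∷≋[] refl ≋-refl)) (≋-trans (+P-identityʳ _) (·P-identityˡ p))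

*P-identityʳ : ∀ p → p *P oneP ≋ p
*P-identityʳ p = ≋-trans (*P-comm p oneP) (*P-identityˡ p)

*P-distribˡ : ∀ p q r → p *P (q +P r) ≋ p *P q +P p *P r
*P-distribˡ p q r = ≋-trans (*P-comm p (q +P r))
  (≋-trans (*P-distribʳ q r p) (+P-cong (*P-comm q p) (*P-comm r p)))

·P≋constP-*P : ∀ c p → c ·P p ≋ constP c *P p
·P≋constP-*P c p = ≋-sym (≋-trans (+P-congʳ (c ·P p) (∷≋[] refl ≋-refl)) (+P-identityʳ (c ·P p)))

constP-*P : ∀ a b → constP (a ℚ.* b) ≋ constP a *P constP b
constP-*P a b = ∷-cong (sym (ℚ.+-identityʳ (a ℚ.* b))) ≋-refl

Poly-commutativeRing : CommutativeRing _ _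
Poly-commutativeRing = record
  { Carrier = Poly
  ; _≈_ = _≋_
  ; _+_ = _+P_
  ; _*_ = _*P_
  ; -_ = -P_
  ; 0# = []
  ; 1# = oneP
  ; isCommutativeRing = record
    { isRing = record
      { +-isAbelianGroup = record
        { isGroup = record
          { isMonoid = record
            { isSemigroup = record
              { isMagma = record { isEquivalence = ≋-isEquivalence ; ∙-cong = +P-cong }
              ; assoc = +P-assoc }
            ; identity = (λ _ → ≋-refl) , +P-identityʳ }
          ; inverse = +P-inverseˡ , +P-inverseʳ
          ; ⁻¹-cong = -P-cong }
        ; comm = +P-comm }
      ; *-cong = *P-cong
      ; *-assoc = *P-assoc
      ; *-identity = *P-identityˡ , *P-identityʳ
      ; distrib = *P-distribˡ , λ p q r → *P-distribʳ q r p }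
    ; *-comm = *P-comm }
  }

constP-homomorphism : ℚ.+-*-rawRing ACR.-Raw-AlmostCommutative⟶ ACR.fromCommutativeRing Poly-commutativeRing
constP-homomorphism = record
  { ⟦_⟧    = constP
  ; +-homo = λ _ _ → ≋-refl
  ; *-homo = constP-*P
  ; -‿homo = λ _ → ≋-refl
  ; 0-homo = ∷≋[] refl ≋-refl
  ; 1-homo = ≋-refl
  }

constP-≟ : ∀ a b → Maybe (constP a ≋ constP b)
constP-≟ a b = Maybe.map (≡⇒≋ ∘ cong constP) (dec⇒weaklyDec ℚ._≟_ a b)

module PolySolver = RingSolver ℚ.+-*-rawRing (ACR.fromCommutativeRing Poly-commutativeRing) constP-homomorphism constP-≟

-P-^P : ∀ p m → (-P p) ^P m ≋ ((ℚ.- 1ℚ) ^ℚ m) ·P p ^P m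
-P-^P p zero    = ≋-sym (·P-identityˡ oneP)
-P-^P p (suc m) = begin
  (-P p) *P (-P p) ^P m                  ≈⟨ *P-congʳ (-P p) (≋-trans (-P-^P p m) (·P≋constP-*P s (p ^P m))) ⟩
  (-P p) *P (constP s *P p ^P m)
    ≈⟨ solve 3 (λ P S Pᵐ → (:- P) :* (S :* Pᵐ) := (:- con 1ℚ :* S) :* (P :* Pᵐ)) ≋-refl p (constP s) (p ^P m) ⟩
  (-P oneP *P constP s) *P p ^P suc m    ≈⟨ *P-congˡ (p ^P suc m) (constP-*P (ℚ.- 1ℚ) s) ⟨
  constP (ℚ.- 1ℚ ℚ.* s) *P p ^P suc m    ≈⟨ ·P≋constP-*P (ℚ.- 1ℚ ℚ.* s) (p ^P suc m) ⟨
  (ℚ.- 1ℚ ℚ.* s) ·P p ^P suc m           ∎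
  where open ≋-Reasoning
        open PolySolver
        s = (ℚ.- 1ℚ) ^ℚ m

coeff-*P-zero : ∀ p q → coeff (p *P q) 0 ≡ coeff p 0 ℚ.* coeff q 0
coeff-*P-zero []      q = sym (ℚ.*-zeroˡ (coeff q 0))
coeff-*P-zero (a ∷ p) q = trans (coeff-+P (a ·P q) (0ℚ ∷ p *P q) 0)
  (trans (ℚ.+-identityʳ (coeff (a ·P q) 0)) (coeff-·P a q 0))

ℕ→ℚ≡mkℚ : ∀ m → ℕ→ℚ m ≡ mkℚ (+ m) 0 (Coprimality.sym (Coprimality.1-coprimeTo m))
ℕ→ℚ≡mkℚ m = ℚ.normalize-coprime (Coprimality.sym (Coprimality.1-coprimeTo m))

ℕ→ℚ-suc : ∀ m → ℕ→ℚ (suc m) ≡ 1ℚ ℚ.+ ℕ→ℚ m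
ℕ→ℚ-suc m = begin
  ℕ→ℚ (suc m)                                                       ≡⟨ cong (λ z → (+ 1 ℤ.+ z) ℚ./ 1) (ℤ.*-identityʳ (+ m)) ⟨
  (+ 1 ℤ.+ + m ℤ.* + 1) ℚ./ 1                                       ≡⟨⟩
  1ℚ ℚ.+ mkℚ (+ m) 0 (Coprimality.sym (Coprimality.1-coprimeTo m))  ≡⟨ cong (1ℚ ℚ.+_) (ℕ→ℚ≡mkℚ m) ⟨
  1ℚ ℚ.+ ℕ→ℚ m                                                      ∎
  where open ≡-Reasoning

ℕ→ℚ-+ : ∀ a b → ℕ→ℚ (a + b) ≡ ℕ→ℚ a ℚ.+ ℕ→ℚ b
ℕ→ℚ-+ zero    b = sym (ℚ.+-identityˡ (ℕ→ℚ b))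
ℕ→ℚ-+ (suc a) b = begin
  ℕ→ℚ (suc (a + b))                ≡⟨ ℕ→ℚ-suc (a + b) ⟩
  1ℚ ℚ.+ ℕ→ℚ (a + b)               ≡⟨ cong (1ℚ ℚ.+_) (ℕ→ℚ-+ a b) ⟩
  1ℚ ℚ.+ (ℕ→ℚ a ℚ.+ ℕ→ℚ b)         ≡⟨ ℚ.+-assoc 1ℚ (ℕ→ℚ a) (ℕ→ℚ b) ⟨
  (1ℚ ℚ.+ ℕ→ℚ a) ℚ.+ ℕ→ℚ b         ≡⟨ cong (ℚ._+ ℕ→ℚ b) (ℕ→ℚ-suc a) ⟨
  ℕ→ℚ (suc a) ℚ.+ ℕ→ℚ b            ∎
  where open ≡-Reasoning

ℕ→ℚ-* : ∀ a b → ℕ→ℚ (a ℕ.* b) ≡ ℕ→ℚ a ℚ.* ℕ→ℚ b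
ℕ→ℚ-* zero    b = sym (ℚ.*-zeroˡ (ℕ→ℚ b))
ℕ→ℚ-* (suc a) b = begin
  ℕ→ℚ (b + a ℕ.* b)                ≡⟨ ℕ→ℚ-+ b (a ℕ.* b) ⟩
  ℕ→ℚ b ℚ.+ ℕ→ℚ (a ℕ.* b)          ≡⟨ cong (ℕ→ℚ b ℚ.+_) (ℕ→ℚ-* a b) ⟩
  ℕ→ℚ b ℚ.+ ℕ→ℚ a ℚ.* ℕ→ℚ b        ≡⟨ solve 2 (λ a b → b :+ a :* b := (con 1ℚ :+ a) :* b) refl (ℕ→ℚ a) (ℕ→ℚ b) ⟩
  (1ℚ ℚ.+ ℕ→ℚ a) ℚ.* ℕ→ℚ b         ≡⟨ cong (ℚ._* ℕ→ℚ b) (ℕ→ℚ-suc a) ⟨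
  ℕ→ℚ (suc a) ℚ.* ℕ→ℚ b            ∎
  where open ≡-Reasoning
        open ℚSolver

1/[1+k]*[1+k]≡1 : ∀ k → (+ 1 ℚ./ suc k) ℚ.* ℕ→ℚ (suc k) ≡ 1ℚ
1/[1+k]*[1+k]≡1 k = trans (cong₂ ℚ._*_ (ℚ.normalize-coprime (Coprimality.1-coprimeTo (suc k))) (ℕ→ℚ≡mkℚ (suc k)))
                          (ℚ.*-inverseˡ (mkℚ (+ suc k) 0 (Coprimality.sym (Coprimality.1-coprimeTo (suc k)))))

ℕ→ℚ-*-·P : ∀ a b p → ℕ→ℚ (a ℕ.* b) ·P p ≋ (constP (ℕ→ℚ a) *P constP (ℕ→ℚ b)) *P p
ℕ→ℚ-*-·P a b p = ≋-trans (·P≋constP-*P (ℕ→ℚ (a ℕ.* b)) p)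
  (*P-congˡ p (≋-trans (≡⇒≋ (cong constP (ℕ→ℚ-* a b))) (constP-*P (ℕ→ℚ a) (ℕ→ℚ b))))

1/[1+k]*P[1+k]≋1 : ∀ k → constP (+ 1 ℚ./ suc k) *P constP (ℕ→ℚ (suc k)) ≋ oneP
1/[1+k]*P[1+k]≋1 k = ≋-trans (≋-sym (constP-*P (+ 1 ℚ./ suc k) (ℕ→ℚ (suc k)))) (≡⇒≋ (cong constP (1/[1+k]*[1+k]≡1 k)))

^ℚ-+ : ∀ a m n → a ^ℚ (m + n) ≡ a ^ℚ m ℚ.* a ^ℚ n
^ℚ-+ a zero    n = sym (ℚ.*-identityˡ (a ^ℚ n))
^ℚ-+ a (suc m) n = trans (cong (a ℚ.*_) (^ℚ-+ a m n)) (sym (ℚ.*-assoc a (a ^ℚ m) (a ^ℚ n)))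

-1^ℚ[m+m]≡1 : ∀ m → (ℚ.- 1ℚ) ^ℚ (m + m) ≡ 1ℚ
-1^ℚ[m+m]≡1 m = trans (^ℚ-+ (ℚ.- 1ℚ) m m) (square≡1 m)
  where
  open ℚSolver
  square≡1 : ∀ m → (ℚ.- 1ℚ) ^ℚ m ℚ.* (ℚ.- 1ℚ) ^ℚ m ≡ 1ℚ
  square≡1 zero    = refl
  square≡1 (suc m) = trans (solve 1 (λ s → (:- con 1ℚ :* s) :* (:- con 1ℚ :* s) := s :* s) refl ((ℚ.- 1ℚ) ^ℚ m)) (square≡1 m)

[-1]^[1+k+d+k]*[-1]^d≡-1 : ∀ k d → (ℚ.- 1ℚ) ^ℚ (suc (k + d) + k) ℚ.* (ℚ.- 1ℚ) ^ℚ d ≡ ℚ.- 1ℚ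
[-1]^[1+k+d+k]*[-1]^d≡-1 k d = begin
  (ℚ.- 1ℚ) ^ℚ (suc (k + d) + k) ℚ.* (ℚ.- 1ℚ) ^ℚ d   ≡⟨ ^ℚ-+ (ℚ.- 1ℚ) (suc (k + d) + k) d ⟨
  (ℚ.- 1ℚ) ^ℚ (suc (k + d) + k + d)                 ≡⟨ cong ((ℚ.- 1ℚ) ^ℚ_)
                                                        (solve 2 (λ k d → con 1 :+ (k :+ d) :+ k :+ d := con 1 :+ ((k :+ d) :+ (k :+ d))) refl k d) ⟩
  ℚ.- 1ℚ ℚ.* (ℚ.- 1ℚ) ^ℚ ((k + d) + (k + d))        ≡⟨ cong (ℚ.- 1ℚ ℚ.*_) (-1^ℚ[m+m]≡1 (k + d)) ⟩
  ℚ.- 1ℚ ℚ.* 1ℚ                                     ≡⟨ ℚ.*-identityʳ (ℚ.- 1ℚ) ⟩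
  ℚ.- 1ℚ                                            ∎
  where open ≡-Reasoning
        open NatSolver

nC[1+k]≡0⊎n∸k≡1+[n∸1+k] : ∀ n k → n C suc k ≡ 0 ⊎ n ∸ k ≡ suc (n ∸ suc k)
nC[1+k]≡0⊎n∸k≡1+[n∸1+k] n k with ℕ.<-≤-connex k n
... | inj₁ k<n = inj₂ (ℕ.+-∸-assoc 1 k<n)
... | inj₂ n≤k = inj₁ (k>n⇒nCk≡0 (s≤s n≤k))

nCk*[n∸k]≡[1+k]*nC[1+k] : ∀ n k → (n C k) ℕ.* (n ∸ k) ≡ suc k ℕ.* (n C suc k)
nCk*[n∸k]≡[1+k]*nC[1+k] zero    k       = trans (cong ((0 C k) ℕ.*_) (ℕ.0∸n≡0 k)) (trans (ℕ.*-zeroʳ (0 C k)) (sym (ℕ.*-zeroʳ (suc k))))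
nCk*[n∸k]≡[1+k]*nC[1+k] (suc n) zero    = trans (ℕ.*-identityˡ (suc n)) (sym (trans (ℕ.+-identityʳ _) (nC1≡n (suc n))))
nCk*[n∸k]≡[1+k]*nC[1+k] (suc n) (suc k) = begin
  (suc n C suc k) ℕ.* (n ∸ k)                  ≡⟨ cong (ℕ._* (n ∸ k)) (nCk+nC[k+1]≡[n+1]C[k+1] n k) ⟨
  (n C k + c) ℕ.* (n ∸ k)                      ≡⟨ ℕ.*-distribʳ-+ (n ∸ k) (n C k) c ⟩
  (n C k) ℕ.* (n ∸ k) + c ℕ.* (n ∸ k)          ≡⟨ cong₂ _+_ (nCk*[n∸k]≡[1+k]*nC[1+k] n k) c*[n∸k]≡c+c*[n∸1+k] ⟩
  suc k ℕ.* c + (c + c ℕ.* (n ∸ suc k))        ≡⟨ cong (λ m → suc k ℕ.* c + (c + m)) (nCk*[n∸k]≡[1+k]*nC[1+k] n (suc k)) ⟩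
  suc k ℕ.* c + (c + suc (suc k) ℕ.* c′)       ≡⟨ solve 3 (λ k c c′ → (con 1 :+ k) :* c :+ (c :+ (con 2 :+ k) :* c′)
                                                               := (con 2 :+ k) :* (c :+ c′)) refl k c c′ ⟩
  suc (suc k) ℕ.* (c + c′)                     ≡⟨ cong (suc (suc k) ℕ.*_) (nCk+nC[k+1]≡[n+1]C[k+1] n (suc k)) ⟩
  suc (suc k) ℕ.* (suc n C suc (suc k))        ∎
  where
  open ≡-Reasoning
  open NatSolver
  c = n C suc k
  c′ = n C suc (suc k)
  c*[n∸k]≡c+c*[n∸1+k] : c ℕ.* (n ∸ k) ≡ c + c ℕ.* (n ∸ suc k)
  c*[n∸k]≡c+c*[n∸1+k] with nC[1+k]≡0⊎n∸k≡1+[n∸1+k] n k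
  ... | inj₁ c≡0 rewrite c≡0 = refl
  ... | inj₂ n∸k≡1+[n∸1+k] = trans (cong (c ℕ.*_) n∸k≡1+[n∸1+k]) (ℕ.*-suc c (n ∸ suc k))

coeff-derivAux : ∀ k p i → coeff (derivAux k p) i ≡ ℕ→ℚ (k + i) ℚ.* coeff p i
coeff-derivAux k []      i       = sym (ℚ.*-zeroʳ (ℕ→ℚ (k + i)))
coeff-derivAux k (a ∷ p) zero    = cong (λ m → ℕ→ℚ m ℚ.* a) (sym (ℕ.+-identityʳ k))
coeff-derivAux k (a ∷ p) (suc i) =
  trans (coeff-derivAux (suc k) p i) (cong (λ m → ℕ→ℚ m ℚ.* coeff p i) (sym (ℕ.+-suc k i)))

coeff-deriv : ∀ p i → coeff (deriv p) i ≡ ℕ→ℚ (suc i) ℚ.* coeff p (suc i)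
coeff-deriv []      i = sym (ℚ.*-zeroʳ (ℕ→ℚ (suc i)))
coeff-deriv (a ∷ p) i = coeff-derivAux 1 p i

coeff-suc≡coeff-deriv : ∀ p i → coeff p (suc i) ≡ (+ 1 ℚ./ suc i) ℚ.* coeff (deriv p) i
coeff-suc≡coeff-deriv p i = begin
  coeff p (suc i)                                       ≡⟨ ℚ.*-identityˡ (coeff p (suc i)) ⟨
  1ℚ ℚ.* coeff p (suc i)                                ≡⟨ cong (ℚ._* coeff p (suc i)) (1/[1+k]*[1+k]≡1 i) ⟨
  (+ 1 ℚ./ suc i) ℚ.* ℕ→ℚ (suc i) ℚ.* coeff p (suc i)   ≡⟨ ℚ.*-assoc (+ 1 ℚ./ suc i) (ℕ→ℚ (suc i)) (coeff p (suc i)) ⟩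
  (+ 1 ℚ./ suc i) ℚ.* (ℕ→ℚ (suc i) ℚ.* coeff p (suc i)) ≡⟨ cong ((+ 1 ℚ./ suc i) ℚ.*_) (coeff-deriv p i) ⟨
  (+ 1 ℚ./ suc i) ℚ.* coeff (deriv p) i                 ∎
  where open ≡-Reasoning

deriv-injective : ∀ {p q} → deriv p ≋ deriv q → coeff p 0 ≡ coeff q 0 → p ≋ q
deriv-injective {p} {q} p′≋q′ p₀≡q₀ = mk≋ λ where
  zero    → p₀≡q₀
  (suc i) → trans (coeff-suc≡coeff-deriv p i)
              (trans (cong ((+ 1 ℚ./ suc i) ℚ.*_) (≋-coeff p′≋q′ i)) (sym (coeff-suc≡coeff-deriv q i)))

deriv-cong : ∀ {p q} → p ≋ q → deriv p ≋ deriv q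
deriv-cong {p} {q} e = mk≋ λ i →
  trans (coeff-deriv p i) (trans (cong (ℕ→ℚ (suc i) ℚ.*_) (≋-coeff e (suc i))) (sym (coeff-deriv q i)))

deriv-+P : ∀ p q → deriv (p +P q) ≋ deriv p +P deriv q
deriv-+P p q = mk≋ λ i → let n = ℕ→ℚ (suc i) in begin
  coeff (deriv (p +P q)) i                        ≡⟨ coeff-deriv (p +P q) i ⟩
  n ℚ.* coeff (p +P q) (suc i)                    ≡⟨ cong (n ℚ.*_) (coeff-+P p q (suc i)) ⟩
  n ℚ.* (coeff p (suc i) ℚ.+ coeff q (suc i))     ≡⟨ ℚ.*-distribˡ-+ n (coeff p (suc i)) (coeff q (suc i)) ⟩
  n ℚ.* coeff p (suc i) ℚ.+ n ℚ.* coeff q (suc i) ≡⟨ cong₂ ℚ._+_ (coeff-deriv p i) (coeff-deriv q i) ⟨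
  coeff (deriv p) i ℚ.+ coeff (deriv q) i         ≡⟨ coeff-+P (deriv p) (deriv q) i ⟨
  coeff (deriv p +P deriv q) i                    ∎
  where open ≡-Reasoning

deriv-·P : ∀ c p → deriv (c ·P p) ≋ c ·P deriv p
deriv-·P c p = mk≋ λ i → let n = ℕ→ℚ (suc i) in begin
  coeff (deriv (c ·P p)) i          ≡⟨ coeff-deriv (c ·P p) i ⟩
  n ℚ.* coeff (c ·P p) (suc i)      ≡⟨ cong (n ℚ.*_) (coeff-·P c p (suc i)) ⟩
  n ℚ.* (c ℚ.* coeff p (suc i))     ≡⟨ solve 3 (λ n c a → n :* (c :* a) := c :* (n :* a)) refl n c (coeff p (suc i)) ⟩
  c ℚ.* (n ℚ.* coeff p (suc i))     ≡⟨ cong (c ℚ.*_) (coeff-deriv p i) ⟨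
  c ℚ.* coeff (deriv p) i           ≡⟨ coeff-·P c (deriv p) i ⟨
  coeff (c ·P deriv p) i            ∎
  where open ≡-Reasoning
        open ℚSolver

deriv--P : ∀ p → deriv (-P p) ≋ -P deriv p
deriv--P p = mk≋ λ i → let n = ℕ→ℚ (suc i) in begin
  coeff (deriv (-P p)) i            ≡⟨ coeff-deriv (-P p) i ⟩
  n ℚ.* coeff (-P p) (suc i)        ≡⟨ cong (n ℚ.*_) (coeff--P p (suc i)) ⟩
  n ℚ.* ℚ.- coeff p (suc i)         ≡⟨ ℚ.neg-distribʳ-* n (coeff p (suc i)) ⟨
  ℚ.- (n ℚ.* coeff p (suc i))       ≡⟨ cong ℚ.-_ (coeff-deriv p i) ⟨
  ℚ.- coeff (deriv p) i             ≡⟨ coeff--P (deriv p) i ⟨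
  coeff (-P deriv p) i              ∎
  where open ≡-Reasoning

0∷≋X*P : ∀ p → 0ℚ ∷ p ≋ X *P p
0∷≋X*P p = ≋-sym (≋-trans (+P-congˡ (0ℚ ∷ oneP *P p) (·P-zeroˡ p)) (∷-cong refl (*P-identityˡ p)))

deriv-∷ : ∀ a p → deriv (a ∷ p) ≋ p +P X *P deriv p
deriv-∷ a p = ≋-trans (mk≋ coeffs) (+P-congʳ p (0∷≋X*P (deriv p)))
  where
  coeffs : ∀ i → coeff (deriv (a ∷ p)) i ≡ coeff (p +P (0ℚ ∷ deriv p)) i
  coeffs zero = begin
    coeff (derivAux 1 p) 0         ≡⟨ coeff-derivAux 1 p 0 ⟩
    1ℚ ℚ.* coeff p 0               ≡⟨ ℚ.*-identityˡ (coeff p 0) ⟩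
    coeff p 0                      ≡⟨ ℚ.+-identityʳ (coeff p 0) ⟨
    coeff p 0 ℚ.+ 0ℚ               ≡⟨ coeff-+P p (0ℚ ∷ deriv p) 0 ⟨
    coeff (p +P (0ℚ ∷ deriv p)) 0  ∎
    where open ≡-Reasoning
  coeffs (suc i) = begin
    coeff (derivAux 1 p) (suc i)                  ≡⟨ coeff-derivAux 1 p (suc i) ⟩
    ℕ→ℚ (suc (suc i)) ℚ.* a₁                      ≡⟨ cong (ℚ._* a₁) (ℕ→ℚ-suc (suc i)) ⟩
    (1ℚ ℚ.+ ℕ→ℚ (suc i)) ℚ.* a₁                   ≡⟨ solve 2 (λ n a → (con 1ℚ :+ n) :* a := a :+ n :* a) refl (ℕ→ℚ (suc i)) a₁ ⟩
    a₁ ℚ.+ ℕ→ℚ (suc i) ℚ.* a₁                     ≡⟨ cong (a₁ ℚ.+_) (coeff-deriv p i) ⟨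
    a₁ ℚ.+ coeff (deriv p) i                      ≡⟨ coeff-+P p (0ℚ ∷ deriv p) (suc i) ⟨
    coeff (p +P (0ℚ ∷ deriv p)) (suc i)           ∎
    where open ≡-Reasoning
          open ℚSolver
          a₁ = coeff p (suc i)

deriv-*P : ∀ p q → deriv (p *P q) ≋ deriv p *P q +P p *P deriv q
deriv-*P []      q = ≋-refl
deriv-*P (a ∷ p) q = begin
  deriv (a ·P q +P (0ℚ ∷ p *P q))
    ≈⟨ deriv-+P (a ·P q) (0ℚ ∷ p *P q) ⟩
  deriv (a ·P q) +P deriv (0ℚ ∷ p *P q)
    ≈⟨ +P-cong (≋-trans (deriv-·P a q) (·P≋constP-*P a (deriv q))) (deriv-∷ 0ℚ (p *P q)) ⟩
  A *P deriv q +P (p *P q +P X *P deriv (p *P q))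
    ≈⟨ +P-congʳ (A *P deriv q) (+P-congʳ (p *P q) (*P-congʳ X (deriv-*P p q))) ⟩
  A *P deriv q +P (p *P q +P X *P (deriv p *P q +P p *P deriv q))
    ≈⟨ solve 6 (λ A P Q P′ Q′ X → A :* Q′ :+ (P :* Q :+ X :* (P′ :* Q :+ P :* Q′))
                              := (P :+ X :* P′) :* Q :+ (A :+ X :* P) :* Q′)
               ≋-refl A p q (deriv p) (deriv q) X ⟩
  (p +P X *P deriv p) *P q +P (A +P X *P p) *P deriv q
    ≈⟨ +P-cong (*P-congˡ q (deriv-∷ a p)) (*P-congˡ (deriv q) (+P-congʳ A (0∷≋X*P p))) ⟨
  deriv (a ∷ p) *P q +P (A +P (0ℚ ∷ p)) *P deriv q
    ≈⟨ +P-congʳ (deriv (a ∷ p) *P q) (*P-congˡ (deriv q) (∷-cong (ℚ.+-identityʳ a) (≋-refl {p}))) ⟩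
  deriv (a ∷ p) *P q +P (a ∷ p) *P deriv q
    ∎
  where open ≋-Reasoning
        open PolySolver
        A = constP a

deriv-^P : ∀ p m → deriv (p ^P suc m) ≋ ℕ→ℚ (suc m) ·P (p ^P m *P deriv p)
deriv-^P p zero = begin
  deriv (p *P oneP)                ≈⟨ deriv-*P p oneP ⟩
  deriv p *P oneP +P p *P []       ≈⟨ +P-congʳ (deriv p *P oneP) (*P-zeroʳ p) ⟩
  deriv p *P oneP +P []            ≈⟨ +P-identityʳ (deriv p *P oneP) ⟩
  deriv p *P oneP                  ≈⟨ solve 1 (λ P′ → P′ :* con 1ℚ := con 1ℚ :* (con 1ℚ :* P′)) ≋-refl (deriv p) ⟩
  oneP *P (oneP *P deriv p)        ≈⟨ ·P≋constP-*P 1ℚ (oneP *P deriv p) ⟨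
  1ℚ ·P (oneP *P deriv p)          ∎
  where open ≋-Reasoning
        open PolySolver
deriv-^P p (suc m) = begin
  deriv (p *P p ^P suc m)
    ≈⟨ deriv-*P p (p ^P suc m) ⟩
  deriv p *P p ^P suc m +P p *P deriv (p ^P suc m)
    ≈⟨ +P-congʳ (deriv p *P p ^P suc m) (*P-congʳ p (≋-trans (deriv-^P p m) (·P≋constP-*P c (p ^P m *P deriv p)))) ⟩
  deriv p *P (p *P p ^P m) +P p *P (constP c *P (p ^P m *P deriv p))
    ≈⟨ solve 4 (λ P P′ Pᵐ C → P′ :* (P :* Pᵐ) :+ P :* (C :* (Pᵐ :* P′)) := (con 1ℚ :+ C) :* ((P :* Pᵐ) :* P′))
               ≋-refl p (deriv p) (p ^P m) (constP c) ⟩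
  constP (1ℚ ℚ.+ c) *P (p ^P suc m *P deriv p)
    ≈⟨ ·P≋constP-*P (1ℚ ℚ.+ c) (p ^P suc m *P deriv p) ⟨
  (1ℚ ℚ.+ c) ·P (p ^P suc m *P deriv p)
    ≈⟨ ·P-congˡ (p ^P suc m *P deriv p) (ℕ→ℚ-suc (suc m)) ⟨
  ℕ→ℚ (suc (suc m)) ·P (p ^P suc m *P deriv p)
    ∎
  where open ≋-Reasoning
        open PolySolver
        c = ℕ→ℚ (suc m)

deriv-X^P : ∀ m → deriv (X ^P m) ≋ ℕ→ℚ m ·P X ^P pred m
deriv-X^P zero    = ≋-sym (·P-zeroˡ oneP)
deriv-X^P (suc m) = ≋-trans (deriv-^P X m) (·P-congʳ (ℕ→ℚ (suc m)) (*P-identityʳ (X ^P m)))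

sumP-first : ∀ m f → sumP (suc m) f ≋ f 0 +P sumP m (f ∘ suc)
sumP-first m f = ≡⇒≋ (cong (λ fs → f 0 +P foldr _+P_ [] fs)
  (trans (map-applyUpTo suc f m) (sym (map-applyUpTo id (f ∘ suc) m))))

sumP-cong : ∀ m {f g} → (∀ i → f i ≋ g i) → sumP m f ≋ sumP m g
sumP-cong zero    f≋g = ≋-refl
sumP-cong (suc m) {f} {g} f≋g =
  ≋-trans (sumP-first m f) (≋-trans (+P-cong (f≋g 0) (sumP-cong m (f≋g ∘ suc))) (≋-sym (sumP-first m g)))

sumP-last : ∀ m f → sumP (suc m) f ≋ sumP m f +P f m
sumP-last zero    f = ≋-trans (sumP-first 0 f) (+P-comm (f 0) [])
sumP-last (suc m) f = begin
  sumP (suc (suc m)) f                          ≈⟨ sumP-first (suc m) f ⟩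
  f 0 +P sumP (suc m) (f ∘ suc)                 ≈⟨ +P-congʳ (f 0) (sumP-last m (f ∘ suc)) ⟩
  f 0 +P (sumP m (f ∘ suc) +P f (suc m))        ≈⟨ +P-assoc (f 0) _ _ ⟨
  (f 0 +P sumP m (f ∘ suc)) +P f (suc m)        ≈⟨ +P-congˡ (f (suc m)) (sumP-first m f) ⟨
  sumP (suc m) f +P f (suc m)                   ∎
  where open ≋-Reasoning

sumP-zero-≋ : ∀ m {f} → (∀ i → f i ≋ []) → sumP m f ≋ []
sumP-zero-≋ zero    f≋[] = ≋-refl
sumP-zero-≋ (suc m) {f} f≋[] = ≋-trans (sumP-first m f) (+P-cong (f≋[] 0) (sumP-zero-≋ m (f≋[] ∘ suc)))

sumP-additive : ∀ (h : Poly → Poly) → (∀ {p q} → p ≋ q → h p ≋ h q) → h [] ≋ [] →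
                (∀ p q → h (p +P q) ≋ h p +P h q) → ∀ m f → h (sumP m f) ≋ sumP m (h ∘ f)
sumP-additive h h-cong h-[] h-+P zero    f = h-[]
sumP-additive h h-cong h-[] h-+P (suc m) f = begin
  h (sumP (suc m) f)                  ≈⟨ h-cong (sumP-first m f) ⟩
  h (f 0 +P sumP m (f ∘ suc))         ≈⟨ h-+P (f 0) _ ⟩
  h (f 0) +P h (sumP m (f ∘ suc))     ≈⟨ +P-congʳ (h (f 0)) (sumP-additive h h-cong h-[] h-+P m (f ∘ suc)) ⟩
  h (f 0) +P sumP m (h ∘ f ∘ suc)     ≈⟨ sumP-first m (h ∘ f) ⟨
  sumP (suc m) (h ∘ f)                ∎
  where open ≋-Reasoning

deriv-sumP : ∀ m f → deriv (sumP m f) ≋ sumP m (deriv ∘ f)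
deriv-sumP = sumP-additive deriv deriv-cong ≋-refl deriv-+P

·P-sumP : ∀ c m f → c ·P sumP m f ≋ sumP m (λ i → c ·P f i)
·P-sumP c = sumP-additive (c ·P_) (·P-congʳ c) ≋-refl (·P-distribˡ c)

*P-sumP : ∀ p m f → p *P sumP m f ≋ sumP m (λ i → p *P f i)
*P-sumP p = sumP-additive (p *P_) (*P-congʳ p) (*P-zeroʳ p) (*P-distribˡ p)

-P-sumP : ∀ m f → -P sumP m f ≋ sumP m (λ i → -P f i)
-P-sumP = sumP-additive -P_ -P-cong ≋-refl -P-distrib
  where -P-distrib : ∀ p q → -P (p +P q) ≋ -P p +P -P q
        -P-distrib = PolySolver.solve 2 (λ p q → :- (p :+ q) := :- p :+ :- q) ≋-refl
          where open PolySolver using (_:+_; :-_; _:=_)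

coeff-sumP-zero : ∀ m f → (∀ i → coeff (f i) 0 ≡ 0ℚ) → coeff (sumP m f) 0 ≡ 0ℚ
coeff-sumP-zero zero    f f₀≡0 = refl
coeff-sumP-zero (suc m) f f₀≡0 = begin
  coeff (sumP (suc m) f) 0                          ≡⟨ ≋-coeff (sumP-first m f) 0 ⟩
  coeff (f 0 +P sumP m (f ∘ suc)) 0                 ≡⟨ coeff-+P (f 0) (sumP m (f ∘ suc)) 0 ⟩
  coeff (f 0) 0 ℚ.+ coeff (sumP m (f ∘ suc)) 0      ≡⟨ cong₂ ℚ._+_ (f₀≡0 0) (coeff-sumP-zero m (f ∘ suc) (f₀≡0 ∘ suc)) ⟩
  0ℚ                                                ∎
  where open ≡-Reasoning

coeff-·P-X^P-suc-zero : ∀ c i → coeff (c ·P X ^P suc i) 0 ≡ 0ℚ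
coeff-·P-X^P-suc-zero c i = trans (coeff-·P c (X ^P suc i) 0)
  (trans (cong (c ℚ.*_) (sym (≋-coeff (0∷≋X*P (X ^P i)) 0))) (ℚ.*-zeroʳ c))

-- Form (1): partial sums of ((1 - x) + x)ⁿ

1-X : Poly
1-X = oneP -P X

recursionStep : ℕ → Poly → Poly
recursionStep k p = p +P (+ 1 ℚ./ suc k) ·P (1-X *P deriv p)

recursionStep-cong : ∀ k {p q} → p ≋ q → recursionStep k p ≋ recursionStep k q
recursionStep-cong k p≋q = +P-cong p≋q (·P-congʳ (+ 1 ℚ./ suc k) (*P-congʳ 1-X (deriv-cong p≋q)))

binomialTerm : ℕ → ℕ → Poly
binomialTerm n j = ℕ→ℚ (n C j) ·P (1-X ^P j *P X ^P (n ∸ j))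

binomialTerm-zero : ∀ n → binomialTerm n 0 ≋ X ^P n
binomialTerm-zero n = ≋-trans (·P-identityˡ _) (*P-identityˡ (X ^P n))

binomialPartialSum : ℕ → ℕ → Poly
binomialPartialSum n k = sumP (suc k) (binomialTerm n)

binomialPartialSum-zero : ∀ n → binomialPartialSum n 0 ≋ X ^P n
binomialPartialSum-zero n = ≋-trans (+P-identityʳ (binomialTerm n 0)) (binomialTerm-zero n)

partialSumDeriv : ℕ → ℕ → Poly
partialSumDeriv n k = ℕ→ℚ ((n C k) ℕ.* (n ∸ k)) ·P (1-X ^P k *P X ^P (n ∸ suc k))

partialSumDeriv≋[1+k]*nC[1+k] : ∀ n k →
  partialSumDeriv n k ≋ (constP (ℕ→ℚ (suc k)) *P constP (ℕ→ℚ (n C suc k))) *P (1-X ^P k *P X ^P (n ∸ suc k))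
partialSumDeriv≋[1+k]*nC[1+k] n k = ≋-trans
  (·P-congˡ (1-X ^P k *P X ^P (n ∸ suc k)) (cong ℕ→ℚ (nCk*[n∸k]≡[1+k]*nC[1+k] n k)))
  (ℕ→ℚ-*-·P (suc k) (n C suc k) (1-X ^P k *P X ^P (n ∸ suc k)))

deriv-binomialTerm-zero : ∀ n → deriv (binomialTerm n 0) ≋ partialSumDeriv n 0
deriv-binomialTerm-zero n = begin
  deriv (binomialTerm n 0)      ≈⟨ deriv-cong (binomialTerm-zero n) ⟩
  deriv (X ^P n)                ≈⟨ deriv-X^P n ⟩
  ℕ→ℚ n ·P X ^P pred n          ≈⟨ ·P-cong (cong ℕ→ℚ (sym (ℕ.*-identityˡ n))) (≋-sym (*P-identityˡ (X ^P pred n))) ⟩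
  partialSumDeriv n 0           ∎
  where open ≋-Reasoning

deriv-binomialTerm-suc : ∀ n k → deriv (binomialTerm n (suc k)) ≋ partialSumDeriv n (suc k) -P partialSumDeriv n k
deriv-binomialTerm-suc n k = begin
  deriv (c ·P term)
    ≈⟨ ≋-trans (deriv-·P c term) (≋-trans (·P≋constP-*P c (deriv term)) (*P-congʳ B (deriv-*P (1-X ^P suc k) (X ^P m)))) ⟩
  B *P (deriv (1-X ^P suc k) *P X ^P m +P 1-X ^P suc k *P deriv (X ^P m))
    ≈⟨ *P-congʳ B (+P-cong (*P-congˡ (X ^P m) (≋-trans (deriv-^P 1-X k) (·P≋constP-*P (ℕ→ℚ (suc k)) _)))
                           (*P-congʳ (1-X ^P suc k) (≋-trans (deriv-X^P m) (·P≋constP-*P (ℕ→ℚ m) _)))) ⟩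
  B *P ((K *P (Y *P (-P oneP))) *P X ^P m +P (1-X *P Y) *P (M *P X ^P pred m))
    ≈⟨ solve 7 (λ B K M y Y Xᵐ Xᵐ⁻¹ → B :* ((K :* (Y :* :- con 1ℚ)) :* Xᵐ :+ (y :* Y) :* (M :* Xᵐ⁻¹))
                                  := (B :* M) :* ((y :* Y) :* Xᵐ⁻¹) :- (K :* B) :* (Y :* Xᵐ))
               ≋-refl B K M 1-X Y (X ^P m) (X ^P pred m) ⟩
  (B *P M) *P (1-X ^P suc k *P X ^P pred m) -P (K *P B) *P (Y *P X ^P m)
    ≈⟨ +P-cong (≋-sym (≋-trans (ℕ→ℚ-*-·P (n C suc k) m _)
                 (*P-congʳ (B *P M) (*P-congʳ (1-X ^P suc k) (≡⇒≋ (cong (X ^P_) (sym (ℕ.pred[m∸n]≡m∸[1+n] n (suc k)))))))))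
               (-P-cong (≋-sym (partialSumDeriv≋[1+k]*nC[1+k] n k))) ⟩
  partialSumDeriv n (suc k) -P partialSumDeriv n k
    ∎
  where open ≋-Reasoning
        open PolySolver
        m = n ∸ suc k
        term = 1-X ^P suc k *P X ^P m
        c = ℕ→ℚ (n C suc k)
        B = constP c
        K = constP (ℕ→ℚ (suc k))
        M = constP (ℕ→ℚ m)
        Y = 1-X ^P k

deriv-binomialPartialSum : ∀ n k → deriv (binomialPartialSum n k) ≋ partialSumDeriv n k
deriv-binomialPartialSum n zero = ≋-trans (deriv-cong (+P-identityʳ (binomialTerm n 0))) (deriv-binomialTerm-zero n)
deriv-binomialPartialSum n (suc k) = begin
  deriv (binomialPartialSum n (suc k))
    ≈⟨ deriv-cong (sumP-last (suc k) (binomialTerm n)) ⟩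
  deriv (binomialPartialSum n k +P binomialTerm n (suc k))
    ≈⟨ deriv-+P (binomialPartialSum n k) (binomialTerm n (suc k)) ⟩
  deriv (binomialPartialSum n k) +P deriv (binomialTerm n (suc k))
    ≈⟨ +P-cong (deriv-binomialPartialSum n k) (deriv-binomialTerm-suc n k) ⟩
  partialSumDeriv n k +P (partialSumDeriv n (suc k) -P partialSumDeriv n k)
    ≈⟨ solve 2 (λ D D′ → D :+ (D′ :- D) := D′) ≋-refl (partialSumDeriv n k) (partialSumDeriv n (suc k)) ⟩
  partialSumDeriv n (suc k)
    ∎
  where open ≋-Reasoning
        open PolySolver

deriv-1-binomialPartialSum : ∀ n k → deriv (oneP -P binomialPartialSum n k) ≋ -P partialSumDeriv n k
deriv-1-binomialPartialSum n k = ≋-trans (deriv-+P oneP (-P binomialPartialSum n k))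
  (≋-trans (deriv--P (binomialPartialSum n k)) (-P-cong (deriv-binomialPartialSum n k)))

1-X*partialSumDeriv/[1+k]≋binomialTerm : ∀ n k →
  (+ 1 ℚ./ suc k) ·P (1-X *P partialSumDeriv n k) ≋ binomialTerm n (suc k)
1-X*partialSumDeriv/[1+k]≋binomialTerm n k = begin
  w ·P (1-X *P partialSumDeriv n k)
    ≈⟨ ≋-trans (·P≋constP-*P w _) (*P-congʳ W (*P-congʳ 1-X (partialSumDeriv≋[1+k]*nC[1+k] n k))) ⟩
  W *P (1-X *P ((K *P B) *P (Y *P Xᵐ)))
    ≈⟨ solve 6 (λ W K B y Y Xᵐ → W :* (y :* ((K :* B) :* (Y :* Xᵐ))) := (W :* K) :* (B :* ((y :* Y) :* Xᵐ)))
               ≋-refl W K B 1-X Y Xᵐ ⟩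
  (W *P K) *P (B *P (1-X ^P suc k *P Xᵐ))
    ≈⟨ *P-congˡ (B *P (1-X ^P suc k *P Xᵐ)) (1/[1+k]*P[1+k]≋1 k) ⟩
  oneP *P (B *P (1-X ^P suc k *P Xᵐ))
    ≈⟨ ≋-trans (*P-identityˡ _) (≋-sym (·P≋constP-*P c _)) ⟩
  binomialTerm n (suc k)
    ∎
  where open ≋-Reasoning
        open PolySolver
        w = + 1 ℚ./ suc k
        W = constP w
        K = constP (ℕ→ℚ (suc k))
        c = ℕ→ℚ (n C suc k)
        B = constP c
        Y = 1-X ^P k
        Xᵐ = X ^P (n ∸ suc k)

Q≋1-binomialPartialSum : ∀ n k → Q n k ≋ oneP -P binomialPartialSum n k
Q≋1-binomialPartialSum n zero = +P-congʳ oneP (-P-cong (≋-sym (binomialPartialSum-zero n)))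
Q≋1-binomialPartialSum n (suc k) = begin
  recursionStep k (Q n k)
    ≈⟨ recursionStep-cong k (Q≋1-binomialPartialSum n k) ⟩
  recursionStep k (oneP -P S)
    ≈⟨ +P-congʳ (oneP -P S) (≋-trans (·P≋constP-*P w _) (*P-congʳ W (*P-congʳ 1-X (deriv-1-binomialPartialSum n k)))) ⟩
  (oneP -P S) +P W *P (1-X *P (-P D))
    ≈⟨ solve 4 (λ S W y D → (con 1ℚ :- S) :+ W :* (y :* (:- D)) := con 1ℚ :- (S :+ W :* (y :* D))) ≋-refl S W 1-X D ⟩
  oneP -P (S +P W *P (1-X *P D))
    ≈⟨ +P-congʳ oneP (-P-cong (+P-congʳ S (≋-trans (≋-sym (·P≋constP-*P w _)) (1-X*partialSumDeriv/[1+k]≋binomialTerm n k)))) ⟩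
  oneP -P (S +P binomialTerm n (suc k))
    ≈⟨ +P-congʳ oneP (-P-cong (sumP-last (suc k) (binomialTerm n))) ⟨
  oneP -P binomialPartialSum n (suc k)
    ∎
  where open ≋-Reasoning
        open PolySolver
        w = + 1 ℚ./ suc k
        W = constP w
        S = binomialPartialSum n k
        D = partialSumDeriv n k

-- Form (3)

recursionStep-1-X^P*P : ∀ k s → recursionStep k (1-X ^P suc k *P s) ≋ 1-X ^P suc (suc k) *P ((+ 1 ℚ./ suc k) ·P deriv s)
recursionStep-1-X^P*P k s = begin
  Y′ *P s +P w ·P (1-X *P deriv (Y′ *P s))
    ≈⟨ +P-congʳ (Y′ *P s) (≋-trans (·P≋constP-*P w _) (*P-congʳ W (*P-congʳ 1-X (deriv-*P Y′ s)))) ⟩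
  Y′ *P s +P W *P (1-X *P (deriv Y′ *P s +P Y′ *P deriv s))
    ≈⟨ +P-congʳ (Y′ *P s) (*P-congʳ W (*P-congʳ 1-X (+P-congˡ (Y′ *P deriv s)
         (*P-congˡ s (≋-trans (deriv-^P 1-X k) (·P≋constP-*P (ℕ→ℚ (suc k)) _)))))) ⟩
  Y′ *P s +P W *P (1-X *P ((K *P (Y *P (-P oneP))) *P s +P (1-X *P Y) *P deriv s))
    ≈⟨ solve 6 (λ y Y s W K s′ → (y :* Y) :* s :+ W :* (y :* ((K :* (Y :* (:- con 1ℚ))) :* s :+ (y :* Y) :* s′))
                              := (y :* (y :* Y)) :* (W :* s′) :+ (con 1ℚ :- W :* K) :* ((y :* Y) :* s))
               ≋-refl 1-X Y s W K (deriv s) ⟩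
  1-X ^P suc (suc k) *P (W *P deriv s) +P (oneP -P W *P K) *P (Y′ *P s)
    ≈⟨ +P-cong (*P-congʳ (1-X ^P suc (suc k)) (≋-sym (·P≋constP-*P w (deriv s))))
               (*P-zero-≋ˡ (Y′ *P s) (≋-trans (+P-congʳ oneP (-P-cong (1/[1+k]*P[1+k]≋1 k))) (+P-inverseʳ oneP))) ⟩
  1-X ^P suc (suc k) *P (w ·P deriv s) +P []
    ≈⟨ +P-identityʳ _ ⟩
  1-X ^P suc (suc k) *P (w ·P deriv s)
    ∎
  where open ≋-Reasoning
        open PolySolver
        w = + 1 ℚ./ suc k
        W = constP w
        K = constP (ℕ→ℚ (suc k))
        Y = 1-X ^P k
        Y′ = 1-X ^P suc k

-- (1 - x)^-(k+1) = ∑ⱼ C(j+k, j) xʲ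
negBinomialTerm : ℕ → ℕ → Poly
negBinomialTerm k j = ℕ→ℚ ((j + k) C j) ·P X ^P j

negBinomialSum : ℕ → ℕ → Poly
negBinomialSum k N = sumP N (negBinomialTerm k)

geometricSum : ∀ n → 1-X *P sumP n (X ^P_) ≋ oneP -P X ^P n
geometricSum zero    = ≋-trans (*P-zeroʳ 1-X) (≋-sym (+P-inverseʳ oneP))
geometricSum (suc n) = begin
  1-X *P sumP (suc n) (X ^P_)               ≈⟨ *P-congʳ 1-X (sumP-last n (X ^P_)) ⟩
  1-X *P (sumP n (X ^P_) +P X ^P n)         ≈⟨ *P-distribˡ 1-X (sumP n (X ^P_)) (X ^P n) ⟩
  1-X *P sumP n (X ^P_) +P 1-X *P X ^P n    ≈⟨ +P-congˡ (1-X *P X ^P n) (geometricSum n) ⟩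
  (oneP -P X ^P n) +P 1-X *P X ^P n         ≈⟨ solve 2 (λ x xⁿ → (con 1ℚ :- xⁿ) :+ (con 1ℚ :- x) :* xⁿ := con 1ℚ :- x :* xⁿ)
                                                      ≋-refl X (X ^P n) ⟩
  oneP -P X ^P suc n                        ∎
  where open ≋-Reasoning
        open PolySolver

negBinomialSum-zero : ∀ N → negBinomialSum 0 N ≋ sumP N (X ^P_)
negBinomialSum-zero N = sumP-cong N λ j →
  ≋-trans (·P-congˡ (X ^P j) (cong ℕ→ℚ (trans (cong (_C j) (ℕ.+-identityʳ j)) (nCn≡1 j)))) (·P-identityˡ (X ^P j))

[1+j+k]C[1+j]*[1+j]/[1+k]≡[j+1+k]Cj : ∀ j k →
  (+ 1 ℚ./ suc k) ℚ.* (ℕ→ℚ ((suc j + k) C suc j) ℚ.* ℕ→ℚ (suc j)) ≡ ℕ→ℚ ((j + suc k) C j)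
[1+j+k]C[1+j]*[1+j]/[1+k]≡[j+1+k]Cj j k = begin
  w ℚ.* (ℕ→ℚ ((suc j + k) C suc j) ℚ.* ℕ→ℚ (suc j)) ≡⟨ cong (λ m → w ℚ.* (ℕ→ℚ (m C suc j) ℚ.* ℕ→ℚ (suc j))) (sym (ℕ.+-suc j k)) ⟩
  w ℚ.* (ℕ→ℚ (N C suc j) ℚ.* ℕ→ℚ (suc j))           ≡⟨ cong (w ℚ.*_) (trans (ℚ.*-comm (ℕ→ℚ (N C suc j)) (ℕ→ℚ (suc j)))
                                                                             (sym (ℕ→ℚ-* (suc j) (N C suc j)))) ⟩
  w ℚ.* ℕ→ℚ (suc j ℕ.* (N C suc j))                 ≡⟨ cong (λ m → w ℚ.* ℕ→ℚ m) (nCk*[n∸k]≡[1+k]*nC[1+k] N j) ⟨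
  w ℚ.* ℕ→ℚ ((N C j) ℕ.* (N ∸ j))                   ≡⟨ cong (λ m → w ℚ.* ℕ→ℚ ((N C j) ℕ.* m)) (ℕ.m+n∸m≡n j (suc k)) ⟩
  w ℚ.* ℕ→ℚ ((N C j) ℕ.* suc k)                     ≡⟨ cong (w ℚ.*_) (ℕ→ℚ-* (N C j) (suc k)) ⟩
  w ℚ.* (ℕ→ℚ (N C j) ℚ.* ℕ→ℚ (suc k))               ≡⟨ solve 3 (λ w a b → w :* (a :* b) := a :* (w :* b))
                                                             refl w (ℕ→ℚ (N C j)) (ℕ→ℚ (suc k)) ⟩
  ℕ→ℚ (N C j) ℚ.* (w ℚ.* ℕ→ℚ (suc k))               ≡⟨ cong (ℕ→ℚ (N C j) ℚ.*_) (1/[1+k]*[1+k]≡1 k) ⟩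
  ℕ→ℚ (N C j) ℚ.* 1ℚ                                ≡⟨ ℚ.*-identityʳ (ℕ→ℚ (N C j)) ⟩
  ℕ→ℚ (N C j)                                       ∎
  where open ≡-Reasoning
        open ℚSolver
        w = + 1 ℚ./ suc k
        N = j + suc k

deriv-negBinomialTerm : ∀ k j → (+ 1 ℚ./ suc k) ·P deriv (negBinomialTerm k (suc j)) ≋ negBinomialTerm (suc k) j
deriv-negBinomialTerm k j = begin
  w ·P deriv (c ·P X ^P suc j)                 ≈⟨ ·P-congʳ w (≋-trans (deriv-·P c (X ^P suc j)) (·P-congʳ c (deriv-X^P (suc j)))) ⟩
  w ·P (c ·P (ℕ→ℚ (suc j) ·P X ^P j))          ≈⟨ ≋-trans (·P-congʳ w (·P-assoc c (ℕ→ℚ (suc j)) (X ^P j))) (·P-assoc w _ (X ^P j)) ⟩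
  (w ℚ.* (c ℚ.* ℕ→ℚ (suc j))) ·P X ^P j        ≈⟨ ·P-congˡ (X ^P j) ([1+j+k]C[1+j]*[1+j]/[1+k]≡[j+1+k]Cj j k) ⟩
  ℕ→ℚ ((j + suc k) C j) ·P X ^P j              ∎
  where open ≋-Reasoning
        w = + 1 ℚ./ suc k
        c = ℕ→ℚ ((suc j + k) C suc j)

deriv-negBinomialSum : ∀ k N → (+ 1 ℚ./ suc k) ·P deriv (negBinomialSum k N) ≋ negBinomialSum (suc k) (pred N)
deriv-negBinomialSum k zero    = ≋-refl
deriv-negBinomialSum k (suc N) = begin
  w ·P deriv (negBinomialSum k (suc N))                  ≈⟨ ·P-congʳ w (deriv-cong (sumP-first N (negBinomialTerm k))) ⟩
  w ·P deriv (negBinomialTerm k 0 +P sumP N f)           ≈⟨ ·P-congʳ w (≋-trans (deriv-+P (negBinomialTerm k 0) (sumP N f))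
                                                                               (deriv-sumP N f)) ⟩
  w ·P sumP N (deriv ∘ f)                                ≈⟨ ·P-sumP w N (deriv ∘ f) ⟩
  sumP N (λ j → w ·P deriv (negBinomialTerm k (suc j)))  ≈⟨ sumP-cong N (deriv-negBinomialTerm k) ⟩
  negBinomialSum (suc k) N                               ∎
  where open ≋-Reasoning
        w = + 1 ℚ./ suc k
        f = negBinomialTerm k ∘ suc

Q≋1-X^P*negBinomialSum : ∀ n k → Q n k ≋ 1-X ^P suc k *P negBinomialSum k (n ∸ k)
Q≋1-X^P*negBinomialSum n zero = ≋-sym (begin
  (1-X *P oneP) *P negBinomialSum 0 n    ≈⟨ *P-cong (*P-identityʳ 1-X) (negBinomialSum-zero n) ⟩
  1-X *P sumP n (X ^P_)                  ≈⟨ geometricSum n ⟩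
  oneP -P X ^P n                         ∎)
  where open ≋-Reasoning
Q≋1-X^P*negBinomialSum n (suc k) = begin
  recursionStep k (Q n k)
    ≈⟨ recursionStep-cong k (Q≋1-X^P*negBinomialSum n k) ⟩
  recursionStep k (1-X ^P suc k *P negBinomialSum k (n ∸ k))
    ≈⟨ recursionStep-1-X^P*P k (negBinomialSum k (n ∸ k)) ⟩
  1-X ^P suc (suc k) *P ((+ 1 ℚ./ suc k) ·P deriv (negBinomialSum k (n ∸ k)))
    ≈⟨ *P-congʳ (1-X ^P suc (suc k)) (deriv-negBinomialSum k (n ∸ k)) ⟩
  1-X ^P suc (suc k) *P negBinomialSum (suc k) (pred (n ∸ k))
    ≡⟨ cong (λ m → 1-X ^P suc (suc k) *P negBinomialSum (suc k) m) (ℕ.pred[m∸n]≡m∸[1+n] n k) ⟩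
  1-X ^P suc (suc k) *P negBinomialSum (suc k) (n ∸ suc k)
    ∎
  where open ≋-Reasoning

coeff-1-X^P-zero : ∀ m → coeff (1-X ^P m) 0 ≡ 1ℚ
coeff-1-X^P-zero zero    = refl
coeff-1-X^P-zero (suc m) = trans (coeff-*P-zero 1-X (1-X ^P m)) (cong (1ℚ ℚ.*_) (coeff-1-X^P-zero m))

indLt≡indLt0∸ : ∀ k n → indLt k n ≡ indLt 0 (n ∸ k)
indLt≡indLt0∸ zero    n       = refl
indLt≡indLt0∸ (suc k) zero    = refl
indLt≡indLt0∸ (suc k) (suc n) = indLt≡indLt0∸ k n

coeff-negBinomialSum-zero : ∀ k N → coeff (negBinomialSum k N) 0 ≡ indLt 0 N
coeff-negBinomialSum-zero k zero    = refl
coeff-negBinomialSum-zero k (suc N) = begin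
  coeff (negBinomialSum k (suc N)) 0                 ≡⟨ ≋-coeff (sumP-first N (negBinomialTerm k)) 0 ⟩
  coeff (negBinomialTerm k 0 +P sumP N f) 0          ≡⟨ coeff-+P (negBinomialTerm k 0) (sumP N f) 0 ⟩
  1ℚ ℚ.+ coeff (sumP N f) 0                          ≡⟨ cong (1ℚ ℚ.+_) (coeff-sumP-zero N f f₀≡0) ⟩
  1ℚ                                                 ∎
  where open ≡-Reasoning
        f = negBinomialTerm k ∘ suc
        f₀≡0 : ∀ j → coeff (f j) 0 ≡ 0ℚ
        f₀≡0 j = coeff-·P-X^P-suc-zero (ℕ→ℚ ((suc j + k) C suc j)) j

coeff-Q-zero : ∀ n k → coeff (Q n k) 0 ≡ indLt k n
coeff-Q-zero n k = begin
  coeff (Q n k) 0                                                   ≡⟨ ≋-coeff (Q≋1-X^P*negBinomialSum n k) 0 ⟩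
  coeff (1-X ^P suc k *P negBinomialSum k (n ∸ k)) 0                ≡⟨ coeff-*P-zero (1-X ^P suc k) _ ⟩
  coeff (1-X ^P suc k) 0 ℚ.* coeff (negBinomialSum k (n ∸ k)) 0     ≡⟨ cong₂ ℚ._*_ (coeff-1-X^P-zero (suc k))
                                                                                       (coeff-negBinomialSum-zero k (n ∸ k)) ⟩
  1ℚ ℚ.* indLt 0 (n ∸ k)                                            ≡⟨ ℚ.*-identityˡ _ ⟩
  indLt 0 (n ∸ k)                                                   ≡⟨ indLt≡indLt0∸ k n ⟨
  indLt k n                                                         ∎
  where open ≡-Reasoning

-- Form (2)

shiftedBinomialSum : ℕ → ℕ → Poly → Poly
shiftedBinomialSum k N w = sumP N (λ i → ℕ→ℚ (k C (N ∸ suc i)) ·P w ^P i)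

shiftedBinomialSum-suc : ∀ k N w → shiftedBinomialSum k (suc N) w ≋ constP (ℕ→ℚ (k C N)) +P w *P shiftedBinomialSum k N w
shiftedBinomialSum-suc k N w = begin
  shiftedBinomialSum k (suc N) w
    ≈⟨ sumP-first N _ ⟩
  ℕ→ℚ (k C N) ·P oneP +P sumP N (λ i → ℕ→ℚ (k C (N ∸ suc i)) ·P w ^P suc i)
    ≈⟨ +P-cong (∷-cong (ℚ.*-identityʳ (ℕ→ℚ (k C N))) ≋-refl) (sumP-cong N pull-w) ⟩
  constP (ℕ→ℚ (k C N)) +P sumP N (λ i → w *P (ℕ→ℚ (k C (N ∸ suc i)) ·P w ^P i))
    ≈⟨ +P-congʳ (constP (ℕ→ℚ (k C N))) (*P-sumP w N _) ⟨
  constP (ℕ→ℚ (k C N)) +P w *P shiftedBinomialSum k N w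
    ∎
  where
  open ≋-Reasoning
  pull-w : ∀ i → ℕ→ℚ (k C (N ∸ suc i)) ·P w ^P suc i ≋ w *P (ℕ→ℚ (k C (N ∸ suc i)) ·P w ^P i)
  pull-w i = ≋-sym (*P-·P (ℕ→ℚ (k C (N ∸ suc i))) w (w ^P i))

shiftedBinomialSum-pascal : ∀ k N w →
  shiftedBinomialSum (suc k) (suc N) w ≋ shiftedBinomialSum k (suc N) w +P shiftedBinomialSum k N w
shiftedBinomialSum-pascal k zero w = ≋-trans (shiftedBinomialSum-suc (suc k) 0 w)
  (≋-sym (≋-trans (+P-identityʳ _) (shiftedBinomialSum-suc k 0 w)))
shiftedBinomialSum-pascal k (suc N) w = begin
  shiftedBinomialSum (suc k) (suc (suc N)) w
    ≈⟨ shiftedBinomialSum-suc (suc k) (suc N) w ⟩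
  constP (ℕ→ℚ (suc k C suc N)) +P w *P shiftedBinomialSum (suc k) (suc N) w
    ≈⟨ +P-cong (≡⇒≋ (cong constP (trans (cong ℕ→ℚ (sym (nCk+nC[k+1]≡[n+1]C[k+1] k N))) (ℕ→ℚ-+ (k C N) (k C suc N)))))
               (*P-congʳ w (shiftedBinomialSum-pascal k N w)) ⟩
  (constP a +P constP b) +P w *P (R₁ +P R₀)
    ≈⟨ solve 5 (λ a b w R₁ R₀ → (a :+ b) :+ w :* (R₁ :+ R₀) := (b :+ w :* R₁) :+ (a :+ w :* R₀))
               ≋-refl (constP a) (constP b) w R₁ R₀ ⟩
  (constP b +P w *P R₁) +P (constP a +P w *P R₀)
    ≈⟨ +P-cong (shiftedBinomialSum-suc k (suc N) w) (shiftedBinomialSum-suc k N w) ⟨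
  shiftedBinomialSum k (suc (suc N)) w +P shiftedBinomialSum k (suc N) w
    ∎
  where open ≋-Reasoning
        open PolySolver
        a = ℕ→ℚ (k C N)
        b = ℕ→ℚ (k C suc N)
        R₁ = shiftedBinomialSum k (suc N) w
        R₀ = shiftedBinomialSum k N w

shiftedBinomialSum≋^P*[1+w]^P : ∀ k d w → shiftedBinomialSum k (suc (k + d)) w ≋ w ^P d *P (oneP +P w) ^P k
shiftedBinomialSum≋^P*[1+w]^P zero zero w = begin
  shiftedBinomialSum 0 1 w                ≈⟨ shiftedBinomialSum-suc 0 0 w ⟩
  oneP +P w *P []                         ≈⟨ +P-congʳ oneP (*P-zeroʳ w) ⟩
  oneP +P []                              ≈⟨ *P-identityˡ oneP ⟨
  oneP *P oneP                            ∎
  where open ≋-Reasoning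
shiftedBinomialSum≋^P*[1+w]^P zero (suc d) w = begin
  shiftedBinomialSum 0 (suc (suc d)) w                   ≈⟨ shiftedBinomialSum-suc 0 (suc d) w ⟩
  constP 0ℚ +P w *P shiftedBinomialSum 0 (suc d) w       ≈⟨ +P-cong (∷≋[] refl ≋-refl) (*P-congʳ w (shiftedBinomialSum≋^P*[1+w]^P 0 d w)) ⟩
  [] +P w *P (w ^P d *P oneP)                            ≈⟨ *P-assoc w (w ^P d) oneP ⟨
  w ^P suc d *P oneP                                     ∎
  where open ≋-Reasoning
shiftedBinomialSum≋^P*[1+w]^P (suc k) d w = begin
  shiftedBinomialSum (suc k) (suc (suc (k + d))) w
    ≈⟨ shiftedBinomialSum-pascal k (suc (k + d)) w ⟩
  shiftedBinomialSum k (suc (suc (k + d))) w +P shiftedBinomialSum k (suc (k + d)) w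
    ≡⟨ cong (λ N → shiftedBinomialSum k (suc N) w +P shiftedBinomialSum k (suc (k + d)) w) (sym (ℕ.+-suc k d)) ⟩
  shiftedBinomialSum k (suc (k + suc d)) w +P shiftedBinomialSum k (suc (k + d)) w
    ≈⟨ +P-cong (shiftedBinomialSum≋^P*[1+w]^P k (suc d) w) (shiftedBinomialSum≋^P*[1+w]^P k d w) ⟩
  w *P w ^P d *P (oneP +P w) ^P k +P w ^P d *P (oneP +P w) ^P k
    ≈⟨ solve 3 (λ w wᵈ v → w :* wᵈ :* v :+ wᵈ :* v := wᵈ :* ((con 1ℚ :+ w) :* v)) ≋-refl w (w ^P d) ((oneP +P w) ^P k) ⟩
  w ^P d *P (oneP +P w) ^P suc k
    ∎
  where open ≋-Reasoning
        open PolySolver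

alternatingCoefficient : ℕ → ℕ → ℕ → ℚ
alternatingCoefficient n k i = ℕ→ℚ (k C (n ∸ suc i)) ℚ.* (((ℚ.- 1ℚ) ^ℚ suc i) ℚ.* (+ 1 ℚ./ suc i))

alternatingSum : ℕ → ℕ → Poly
alternatingSum n k = sumP n (λ i → alternatingCoefficient n k i ·P X ^P suc i)

alternatingScale : ℕ → ℕ → ℚ
alternatingScale n k = (ℚ.- ((ℕ→ℚ n ℚ.- ℕ→ℚ k) ℚ.* ℕ→ℚ (n C k))) ℚ.* ((ℚ.- 1ℚ) ^ℚ (n + k))

alternatingForm : ℕ → ℕ → Poly
alternatingForm n k = alternatingScale n k ·P alternatingSum n k +P constP (indLt k n)

c*[-1]^[1+i]/[1+i]*[1+i]≡-c*[-1]^i : ∀ c i →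
  (c ℚ.* (((ℚ.- 1ℚ) ^ℚ suc i) ℚ.* (+ 1 ℚ./ suc i))) ℚ.* ℕ→ℚ (suc i) ≡ ℚ.- (c ℚ.* (ℚ.- 1ℚ) ^ℚ i)
c*[-1]^[1+i]/[1+i]*[1+i]≡-c*[-1]^i c i = begin
  (c ℚ.* ((ℚ.- 1ℚ ℚ.* s) ℚ.* w)) ℚ.* n   ≡⟨ solve 4 (λ c s w n → (c :* ((:- con 1ℚ :* s) :* w)) :* n := (:- (c :* s)) :* (w :* n))
                                                   refl c s w n ⟩
  ℚ.- (c ℚ.* s) ℚ.* (w ℚ.* n)            ≡⟨ cong (ℚ.- (c ℚ.* s) ℚ.*_) (1/[1+k]*[1+k]≡1 i) ⟩
  ℚ.- (c ℚ.* s) ℚ.* 1ℚ                   ≡⟨ ℚ.*-identityʳ (ℚ.- (c ℚ.* s)) ⟩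
  ℚ.- (c ℚ.* s)                          ∎
  where open ≡-Reasoning
        open ℚSolver
        s = (ℚ.- 1ℚ) ^ℚ i
        w = + 1 ℚ./ suc i
        n = ℕ→ℚ (suc i)

deriv-alternatingSum : ∀ n k → deriv (alternatingSum n k) ≋ -P shiftedBinomialSum k n (-P X)
deriv-alternatingSum n k = begin
  deriv (alternatingSum n k)                          ≈⟨ deriv-sumP n _ ⟩
  sumP n (λ i → deriv (b i ·P X ^P suc i))            ≈⟨ sumP-cong n deriv-term ⟩
  sumP n (λ i → -P (c i ·P (-P X) ^P i))              ≈⟨ -P-sumP n (λ i → c i ·P (-P X) ^P i) ⟨
  -P shiftedBinomialSum k n (-P X)                    ∎
  where
  open ≋-Reasoning
  c : ℕ → ℚ
  c i = ℕ→ℚ (k C (n ∸ suc i))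
  b : ℕ → ℚ
  b = alternatingCoefficient n k
  deriv-term : ∀ i → deriv (b i ·P X ^P suc i) ≋ -P (c i ·P (-P X) ^P i)
  deriv-term i = begin
    deriv (b i ·P X ^P suc i)                          ≈⟨ ≋-trans (deriv-·P (b i) (X ^P suc i)) (·P-congʳ (b i) (deriv-X^P (suc i))) ⟩
    b i ·P (ℕ→ℚ (suc i) ·P X ^P i)                     ≈⟨ ·P-assoc (b i) (ℕ→ℚ (suc i)) (X ^P i) ⟩
    (b i ℚ.* ℕ→ℚ (suc i)) ·P X ^P i                    ≈⟨ ·P-congˡ (X ^P i) (c*[-1]^[1+i]/[1+i]*[1+i]≡-c*[-1]^i (c i) i) ⟩
    (ℚ.- (c i ℚ.* s)) ·P X ^P i                        ≈⟨ -·P (c i ℚ.* s) (X ^P i) ⟩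
    -P ((c i ℚ.* s) ·P X ^P i)                         ≈⟨ -P-cong (≋-trans (·P-congʳ (c i) (-P-^P X i)) (·P-assoc (c i) s (X ^P i))) ⟨
    -P (c i ·P (-P X) ^P i)                            ∎
    where s = (ℚ.- 1ℚ) ^ℚ i

deriv-alternatingForm : ∀ n k → deriv (alternatingForm n k) ≋ alternatingScale n k ·P (-P shiftedBinomialSum k n (-P X))
deriv-alternatingForm n k = ≋-trans (deriv-+P (alternatingScale n k ·P alternatingSum n k) (constP (indLt k n)))
  (≋-trans (+P-identityʳ _) (≋-trans (deriv-·P (alternatingScale n k) (alternatingSum n k))
    (·P-congʳ (alternatingScale n k) (deriv-alternatingSum n k))))

alternatingScale*[-1]^d : ∀ k d → alternatingScale (suc (k + d)) k ℚ.* (ℚ.- 1ℚ) ^ℚ d ≡ ℕ→ℚ ((suc (k + d) C k) ℕ.* suc d)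
alternatingScale*[-1]^d k d = begin
  ℚ.- ((ℕ→ℚ n ℚ.- ℕ→ℚ k) ℚ.* c) ℚ.* (ℚ.- 1ℚ) ^ℚ (n + k) ℚ.* (ℚ.- 1ℚ) ^ℚ d
    ≡⟨ ℚ.*-assoc (ℚ.- ((ℕ→ℚ n ℚ.- ℕ→ℚ k) ℚ.* c)) _ _ ⟩
  ℚ.- ((ℕ→ℚ n ℚ.- ℕ→ℚ k) ℚ.* c) ℚ.* ((ℚ.- 1ℚ) ^ℚ (n + k) ℚ.* (ℚ.- 1ℚ) ^ℚ d)
    ≡⟨ cong₂ (λ a b → ℚ.- ((a ℚ.- ℕ→ℚ k) ℚ.* c) ℚ.* b) n≡k+[1+d] ([-1]^[1+k+d+k]*[-1]^d≡-1 k d) ⟩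
  ℚ.- ((ℕ→ℚ k ℚ.+ ℕ→ℚ (suc d) ℚ.- ℕ→ℚ k) ℚ.* c) ℚ.* ℚ.- 1ℚ
    ≡⟨ solve 3 (λ k s c → (:- ((k :+ s :- k) :* c)) :* (:- con 1ℚ) := c :* s) refl (ℕ→ℚ k) (ℕ→ℚ (suc d)) c ⟩
  c ℚ.* ℕ→ℚ (suc d)
    ≡⟨ ℕ→ℚ-* (n C k) (suc d) ⟨
  ℕ→ℚ ((n C k) ℕ.* suc d)
    ∎
  where
  open ≡-Reasoning
  open ℚSolver
  n = suc (k + d)
  c = ℕ→ℚ (n C k)
  n≡k+[1+d] : ℕ→ℚ n ≡ ℕ→ℚ k ℚ.+ ℕ→ℚ (suc d)
  n≡k+[1+d] = trans (cong ℕ→ℚ (sym (ℕ.+-suc k d))) (ℕ→ℚ-+ k (suc d))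

alternatingScale-≥ : ∀ {n k} → n ≤ k → alternatingScale n k ≡ 0ℚ
alternatingScale-≥ {n} {k} n≤k =
  trans (cong (λ a → ℚ.- a ℚ.* (ℚ.- 1ℚ) ^ℚ (n + k)) [n-k]*nCk≡0) (ℚ.*-zeroˡ ((ℚ.- 1ℚ) ^ℚ (n + k)))
  where
  [n-k]*nCk≡0 : (ℕ→ℚ n ℚ.- ℕ→ℚ k) ℚ.* ℕ→ℚ (n C k) ≡ 0ℚ
  [n-k]*nCk≡0 with ℕ.m≤n⇒m<n∨m≡n n≤k
  ... | inj₁ n<k = trans (cong (λ m → (ℕ→ℚ n ℚ.- ℕ→ℚ k) ℚ.* ℕ→ℚ m) (k>n⇒nCk≡0 n<k)) (ℚ.*-zeroʳ (ℕ→ℚ n ℚ.- ℕ→ℚ k))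
  ... | inj₂ refl = trans (cong (ℚ._* ℕ→ℚ (n C n)) (ℚ.+-inverseʳ (ℕ→ℚ n))) (ℚ.*-zeroˡ (ℕ→ℚ (n C n)))

partialSumDeriv-≥ : ∀ {n k} → n ≤ k → partialSumDeriv n k ≋ []
partialSumDeriv-≥ {n} {k} n≤k = ≋-trans
  (·P-congˡ (1-X ^P k *P X ^P (n ∸ suc k)) (cong (λ m → ℕ→ℚ ((n C k) ℕ.* m)) (ℕ.m≤n⇒m∸n≡0 n≤k)))
  (≋-trans (·P-congˡ _ (cong ℕ→ℚ (ℕ.*-zeroʳ (n C k)))) (·P-zeroˡ _))

deriv-alternatingForm-≥ : ∀ {n k} → n ≤ k → deriv (alternatingForm n k) ≋ -P partialSumDeriv n k
deriv-alternatingForm-≥ {n} {k} n≤k = begin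
  deriv (alternatingForm n k)                                      ≈⟨ deriv-alternatingForm n k ⟩
  alternatingScale n k ·P (-P shiftedBinomialSum k n (-P X))   ≈⟨ ≋-trans (·P-congˡ _ (alternatingScale-≥ n≤k)) (·P-zeroˡ _) ⟩
  []                                                           ≈⟨ -P-cong (partialSumDeriv-≥ n≤k) ⟨
  -P partialSumDeriv n k                                       ∎
  where open ≋-Reasoning

deriv-alternatingForm-< : ∀ k d → deriv (alternatingForm (suc (k + d)) k) ≋ -P partialSumDeriv (suc (k + d)) k
deriv-alternatingForm-< k d = begin
  deriv (alternatingForm n k)
    ≈⟨ deriv-alternatingForm n k ⟩
  a ·P (-P shiftedBinomialSum k n (-P X))
    ≈⟨ ·P--P a _ ⟩
  -P (a ·P shiftedBinomialSum k n (-P X))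
    ≈⟨ -P-cong (·P-congʳ a (≋-trans (shiftedBinomialSum≋^P*[1+w]^P k d (-P X)) (*P-congˡ (1-X ^P k) (-P-^P X d)))) ⟩
  -P (a ·P ((s ·P X ^P d) *P 1-X ^P k))
    ≈⟨ -P-cong (≋-trans (·P-congʳ a (≋-trans (·P-*P s (X ^P d) (1-X ^P k)) (·P-congʳ s (*P-comm (X ^P d) (1-X ^P k))))) (·P-assoc a s _)) ⟩
  -P ((a ℚ.* s) ·P (1-X ^P k *P X ^P d))
    ≈⟨ -P-cong (·P-cong (alternatingScale*[-1]^d k d) (*P-congʳ (1-X ^P k) (≡⇒≋ (cong (X ^P_) (sym (ℕ.m+n∸m≡n k d)))))) ⟩
  -P (ℕ→ℚ ((n C k) ℕ.* suc d) ·P (1-X ^P k *P X ^P (n ∸ suc k)))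
    ≡⟨ cong (λ m → -P (ℕ→ℚ ((n C k) ℕ.* m) ·P (1-X ^P k *P X ^P (n ∸ suc k)))) (sym n∸k≡1+d) ⟩
  -P partialSumDeriv n k
    ∎
  where open ≋-Reasoning
        n = suc (k + d)
        a = alternatingScale n k
        s = (ℚ.- 1ℚ) ^ℚ d
        n∸k≡1+d : n ∸ k ≡ suc d
        n∸k≡1+d = trans (cong (_∸ k) (sym (ℕ.+-suc k d))) (ℕ.m+n∸m≡n k (suc d))

deriv-alternatingForm≋-partialSumDeriv : ∀ n k → deriv (alternatingForm n k) ≋ -P partialSumDeriv n k
deriv-alternatingForm≋-partialSumDeriv n k with ℕ.<-≤-connex k n
... | inj₂ n≤k = deriv-alternatingForm-≥ n≤k
... | inj₁ k<n with ℕ.≤⇒≤″ k<n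
...   | record { quotient = d ; equality = refl } = deriv-alternatingForm-< k d

coeff-alternatingForm-zero : ∀ n k → coeff (alternatingForm n k) 0 ≡ indLt k n
coeff-alternatingForm-zero n k = begin
  coeff (alternatingForm n k) 0                             ≡⟨ coeff-+P (a ·P alternatingSum n k) (constP (indLt k n)) 0 ⟩
  coeff (a ·P alternatingSum n k) 0 ℚ.+ indLt k n       ≡⟨ cong (ℚ._+ indLt k n) (coeff-·P a (alternatingSum n k) 0) ⟩
  a ℚ.* coeff (alternatingSum n k) 0 ℚ.+ indLt k n      ≡⟨ cong (λ x → a ℚ.* x ℚ.+ indLt k n)
                                                           (coeff-sumP-zero n _ λ i → coeff-·P-X^P-suc-zero (alternatingCoefficient n k i) i) ⟩
  a ℚ.* 0ℚ ℚ.+ indLt k n                                ≡⟨ cong (ℚ._+ indLt k n) (ℚ.*-zeroʳ a) ⟩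
  0ℚ ℚ.+ indLt k n                                      ≡⟨ ℚ.+-identityˡ (indLt k n) ⟩
  indLt k n                                             ∎
  where open ≡-Reasoning
        a = alternatingScale n k

Q≋alternatingForm : ∀ n k → Q n k ≋ alternatingForm n k
Q≋alternatingForm n k = deriv-injective
  (≋-trans (deriv-cong (Q≋1-binomialPartialSum n k))
    (≋-trans (deriv-1-binomialPartialSum n k) (≋-sym (deriv-alternatingForm≋-partialSumDeriv n k))))
  (trans (coeff-Q-zero n k) (sym (coeff-alternatingForm-zero n k)))

-- The generating function

*S-zero : ∀ F G → (F *S G) 0 ≋ F 0 *P G 0
*S-zero F G = +P-identityʳ (F 0 *P G 0)

*S-suc-degree≤1 : ∀ F G → (∀ i → F (suc (suc i)) ≋ []) → ∀ k → (F *S G) (suc k) ≋ F 0 *P G (suc k) +P F 1 *P G k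
*S-suc-degree≤1 F G F₂₊≋[] k = begin
  sumP (suc (suc k)) h                       ≈⟨ sumP-first (suc k) h ⟩
  h 0 +P sumP (suc k) (h ∘ suc)              ≈⟨ +P-congʳ (h 0) (sumP-first k (h ∘ suc)) ⟩
  h 0 +P (h 1 +P sumP k (h ∘ suc ∘ suc))     ≈⟨ +P-congʳ (h 0) (+P-congʳ (h 1)
                                                  (sumP-zero-≋ k λ i → *P-zero-≋ˡ (G (k ∸ suc i)) (F₂₊≋[] i))) ⟩
  h 0 +P (h 1 +P [])                         ≈⟨ +P-congʳ (h 0) (+P-identityʳ (h 1)) ⟩
  F 0 *P G (suc k) +P F 1 *P G k             ∎
  where open ≋-Reasoning
        h = λ i → F i *P G (suc k ∸ i)

1-T : Ser
1-T = oneS -S T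

x+[1-x]t : Ser
x+[1-x]t = oneS -S 1-T *S constS 1-X

x+[1-x]t-zero : x+[1-x]t 0 ≋ X
x+[1-x]t-zero = ≋-trans (+P-congʳ oneP (-P-cong (≋-trans (*S-zero 1-T (constS 1-X)) (*P-identityˡ 1-X))))
  (PolySolver.solve 1 (λ x → con 1ℚ :- (con 1ℚ :- x) := x) ≋-refl X)
  where open PolySolver using (_:-_; con; _:=_)

x+[1-x]t-one : x+[1-x]t 1 ≋ 1-X
x+[1-x]t-one = ≋-trans
  (-P-cong (≋-trans (*S-suc-degree≤1 1-T (constS 1-X) (λ _ → ≋-refl) 0) (+P-congˡ ((-P oneP) *P 1-X) (*P-zeroʳ oneP))))
  (PolySolver.solve 1 (λ y → :- ((:- con 1ℚ) :* y) := y) ≋-refl 1-X)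
  where open PolySolver using (_:*_; :-_; con; _:=_)

x+[1-x]t-suc-suc : ∀ i → x+[1-x]t (suc (suc i)) ≋ []
x+[1-x]t-suc-suc i = -P-cong (≋-trans (*S-suc-degree≤1 1-T (constS 1-X) (λ _ → ≋-refl) (suc i))
  (+P-cong (*P-zeroʳ oneP) (*P-zeroʳ (-P oneP))))

binomialTerm-pascal : ∀ m k → X *P binomialTerm m (suc k) +P 1-X *P binomialTerm m k ≋ binomialTerm (suc m) (suc k)
binomialTerm-pascal m k = begin
  X *P binomialTerm m (suc k) +P 1-X *P binomialTerm m k
    ≈⟨ +P-cong (*P-congʳ X (·P≋constP-*P c₁ (1-X ^P suc k *P X ^P (m ∸ suc k)))) (*P-congʳ 1-X (·P≋constP-*P c₀ (Y *P X ^P (m ∸ k)))) ⟩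
  X *P (C₁ *P ((1-X *P Y) *P X ^P (m ∸ suc k))) +P 1-X *P (C₀ *P (Y *P X ^P (m ∸ k)))
    ≈⟨ solve 7 (λ x C₁ y Y Xʲ C₀ Xᵐ → x :* (C₁ :* ((y :* Y) :* Xʲ)) :+ y :* (C₀ :* (Y :* Xᵐ))
                                    := (y :* Y) :* (C₁ :* (x :* Xʲ)) :+ (y :* Y) :* (C₀ :* Xᵐ))
               ≋-refl X C₁ 1-X Y (X ^P (m ∸ suc k)) C₀ (X ^P (m ∸ k)) ⟩
  1-X ^P suc k *P (C₁ *P (X *P X ^P (m ∸ suc k))) +P 1-X ^P suc k *P (C₀ *P X ^P (m ∸ k))
    ≈⟨ +P-congˡ _ (*P-congʳ (1-X ^P suc k) C₁*X^[m∸1+k]≋C₁*X^[m∸k]) ⟩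
  1-X ^P suc k *P (C₁ *P X ^P (m ∸ k)) +P 1-X ^P suc k *P (C₀ *P X ^P (m ∸ k))
    ≈⟨ solve 4 (λ Yᵏ⁺¹ C₁ C₀ Xᵐ → Yᵏ⁺¹ :* (C₁ :* Xᵐ) :+ Yᵏ⁺¹ :* (C₀ :* Xᵐ) := (C₀ :+ C₁) :* (Yᵏ⁺¹ :* Xᵐ))
               ≋-refl (1-X ^P suc k) C₁ C₀ (X ^P (m ∸ k)) ⟩
  (C₀ +P C₁) *P (1-X ^P suc k *P X ^P (m ∸ k))
    ≈⟨ *P-congˡ _ (≡⇒≋ (cong constP (trans (sym (ℕ→ℚ-+ (m C k) (m C suc k))) (cong ℕ→ℚ (nCk+nC[k+1]≡[n+1]C[k+1] m k))))) ⟩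
  constP (ℕ→ℚ (suc m C suc k)) *P (1-X ^P suc k *P X ^P (m ∸ k))
    ≈⟨ ·P≋constP-*P (ℕ→ℚ (suc m C suc k)) _ ⟨
  binomialTerm (suc m) (suc k)
    ∎
  where
  open ≋-Reasoning
  open PolySolver
  c₁ = ℕ→ℚ (m C suc k)
  c₀ = ℕ→ℚ (m C k)
  C₁ = constP c₁
  C₀ = constP c₀
  Y = 1-X ^P k
  C₁*X^[m∸1+k]≋C₁*X^[m∸k] : C₁ *P (X *P X ^P (m ∸ suc k)) ≋ C₁ *P X ^P (m ∸ k)
  C₁*X^[m∸1+k]≋C₁*X^[m∸k] with nC[1+k]≡0⊎n∸k≡1+[n∸1+k] m k
  ... | inj₁ c≡0 = ≋-trans (*P-zero-≋ˡ _ C₁≋[]) (≋-sym (*P-zero-≋ˡ _ C₁≋[]))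
    where C₁≋[] = ∷≋[] (cong ℕ→ℚ c≡0) ≋-refl
  ... | inj₂ m∸k≡1+[m∸1+k] = ≡⇒≋ (cong (λ j → C₁ *P X ^P j) (sym m∸k≡1+[m∸1+k]))

x+[1-x]t^S-coeff : ∀ m k → (x+[1-x]t ^S m) k ≋ binomialTerm m k
x+[1-x]t^S-coeff zero    zero    = ≋-refl
x+[1-x]t^S-coeff zero    (suc k) = ≋-sym (·P-zeroˡ _)
x+[1-x]t^S-coeff (suc m) zero    = begin
  (x+[1-x]t *S x+[1-x]t ^S m) 0     ≈⟨ ≋-trans (*S-zero x+[1-x]t (x+[1-x]t ^S m)) (*P-cong x+[1-x]t-zero (x+[1-x]t^S-coeff m 0)) ⟩
  X *P binomialTerm m 0             ≈⟨ *P-congʳ X (binomialTerm-zero m) ⟩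
  X ^P suc m                        ≈⟨ binomialTerm-zero (suc m) ⟨
  binomialTerm (suc m) 0            ∎
  where open ≋-Reasoning
x+[1-x]t^S-coeff (suc m) (suc k) = begin
  (x+[1-x]t *S x+[1-x]t ^S m) (suc k)
    ≈⟨ *S-suc-degree≤1 x+[1-x]t (x+[1-x]t ^S m) x+[1-x]t-suc-suc k ⟩
  x+[1-x]t 0 *P (x+[1-x]t ^S m) (suc k) +P x+[1-x]t 1 *P (x+[1-x]t ^S m) k
    ≈⟨ +P-cong (*P-cong x+[1-x]t-zero (x+[1-x]t^S-coeff m (suc k))) (*P-cong x+[1-x]t-one (x+[1-x]t^S-coeff m k)) ⟩
  X *P binomialTerm m (suc k) +P 1-X *P binomialTerm m k
    ≈⟨ binomialTerm-pascal m k ⟩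
  binomialTerm (suc m) (suc k)
    ∎
  where open ≋-Reasoning

generatingFunction : ∀ n k → (1-T *S Q n) k ≋ (oneS -S x+[1-x]t ^S n) k
generatingFunction n zero = begin
  (1-T *S Q n) 0          ≈⟨ ≋-trans (*S-zero 1-T (Q n)) (*P-identityˡ (Q n 0)) ⟩
  oneP -P X ^P n          ≈⟨ +P-congʳ oneP (-P-cong (≋-trans (x+[1-x]t^S-coeff n 0) (binomialTerm-zero n))) ⟨
  oneP -P (x+[1-x]t ^S n) 0 ∎
  where open ≋-Reasoning
generatingFunction n (suc k) = begin
  (1-T *S Q n) (suc k)
    ≈⟨ *S-suc-degree≤1 1-T (Q n) (λ _ → ≋-refl) k ⟩
  oneP *P Q n (suc k) +P (-P oneP) *P Q n k
    ≈⟨ +P-cong (*P-congʳ oneP (≋-trans (Q≋1-binomialPartialSum n (suc k)) (+P-congʳ oneP (-P-cong (sumP-last (suc k) (binomialTerm n))))))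
               (*P-congʳ (-P oneP) (Q≋1-binomialPartialSum n k)) ⟩
  oneP *P (oneP -P (S +P binomialTerm n (suc k))) +P (-P oneP) *P (oneP -P S)
    ≈⟨ solve 2 (λ S b → con 1ℚ :* (con 1ℚ :- (S :+ b)) :+ (:- con 1ℚ) :* (con 1ℚ :- S) := :- b) ≋-refl S (binomialTerm n (suc k)) ⟩
  -P binomialTerm n (suc k)
    ≈⟨ -P-cong (x+[1-x]t^S-coeff n (suc k)) ⟨
  (oneS -S x+[1-x]t ^S n) (suc k)
    ∎
  where open ≋-Reasoning
        open PolySolver
        S = binomialPartialSum n k

mainTheorem1 : (n : ℕ) → 1 ≤ n →
    ((k : ℕ) →
      (Q n k ≈P oneP -P sumP (suc k) (λ j → ℕ→ℚ (n C j) ·P (((oneP -P X) ^P j) *P (X ^P (n ∸ j)))))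
      × (Q n k ≈P ((- ((ℕ→ℚ n - ℕ→ℚ k) * ℕ→ℚ (n C k))) * ((- 1ℚ) ^ℚ (n + k)))
                    ·P sumP n (λ i → (ℕ→ℚ (k C (n ∸ suc i)) * (((- 1ℚ) ^ℚ suc i) * (+ 1 / suc i))) ·P (X ^P suc i))
                  +P constP (indLt k n))
      × (Q n k ≈P ((oneP -P X) ^P suc k) *P sumP (n ∸ k) (λ j → ℕ→ℚ ((j + k) C j) ·P (X ^P j))))
    × ((oneS -S T) *S (λ m → Q n m) ≈S oneS -S ((oneS -S ((oneS -S T) *S constS (oneP -P X))) ^S n))
-- The identities hold for n = 0 as well.
mainTheorem1 n _ =
  (λ k → ≋-coeff (Q≋1-binomialPartialSum n k) , ≋-coeff (Q≋alternatingForm n k) , ≋-coeff (Q≋1-X^P*negBinomialSum n k)) ,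
  (λ k → ≋-coeff (generatingFunction n k))
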